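{- Let $n\geq 3$ be an integer and $p$ an odd prime with $p\nmid n(n-1)$. Let $t\in\mathbb{F}_p^\times$, let $f_t(y)=y^n-y^{n-1}+\frac{(n-1)^{n-1}}{n^n}t\in\mathbb{F}_p[y]$, let $\alpha=\frac{4(1-n)^{n-1}}{n^n}\in\mathbb{F}_p$, and let $\beta_n(t)=1$ if $n$ is odd and $\beta_n(t)=1-(p-1)\varphi((1-n)t)$ if $n$ is even. Let $$A_n(t)=\sum_{\chi\in\widehat{\mathbb{F}_p^\times}}g(\varphi\chi^{n-1})\,g(\overline{\chi}^n)\,g(\overline{\chi})\,g(\chi^2)\,\overline{\chi}(\alpha t).$$ Then $$A_n(t)=p(p-1)g(\varphi)\sum_{\substack{a\in\mathbb{F}_p\\ f_t(a)\equiv 0\pmod p}}\varphi(a(a-1))+(p-1)g(\varphi)\beta_n(t).$$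
   Context: $\widehat{\mathbb{F}_p^\times}$ is the group of multiplicative characters of $\mathbb{F}_p^\times$; each character $\chi$ (including the trivial one) is extended to $\mathbb{F}_p$ by $\chi(0)=0$, and $\overline{\chi}$ denotes the inverse character. $\varphi$ is the quadratic character. For a fixed primitive $p$-th root of unity $\zeta_p$, the Gauss sum is $g(\chi)=\sum_{x\in\mathbb{F}_p}\chi(x)\zeta_p^x$. The sum over $a$ is over distinct elements of $\mathbb{F}_p$. -}

module Defs where

open import Level using (Level; _⊔_)
open import Data.Nat as ℕ using (ℕ; zero; suc; _≡ᵇ_; _∸_; _/_)
import Data.Nat.DivMod as DM
open import Data.Bool using (Bool; true; false; if_then_else_)
open import Data.Sum using (_⊎_)
open import Data.Product using (_×_)
open import Relation.Nullary using (¬_)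
open import Relation.Binary.PropositionalEquality using (_≡_)
open import Algebra.Bundles using (CommutativeRing)

-- reduction of a natural number modulo m (elements of F_p are represented by ℕ mod p)
_mod_ : ℕ → ℕ → ℕ
x mod zero = x
x mod suc m = x DM.% suc m

unitMod : ℕ → ℕ → Set
unitMod p x = ¬ (x mod p ≡ 0)

-- inverse of a unit mod a prime p, via Fermat: x^(p-2)
invMod : ℕ → ℕ → ℕ
invMod p x = (x ℕ.^ (p ∸ 2)) mod p

IsPrimitiveRoot : ℕ → ℕ → Set
IsPrimitiveRoot p g = unitMod p g × (∀ k → 1 ℕ.≤ k → k ℕ.< p ∸ 1 → ¬ ((g ℕ.^ k) mod p ≡ 1))

module InRing {c ℓ : Level} (R : CommutativeRing c ℓ) where
  open CommutativeRing R

  _^ᴿ_ : Carrier → ℕ → Carrier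
  x ^ᴿ zero = 1#
  x ^ᴿ suc k = x * (x ^ᴿ k)

  fromℕ : ℕ → Carrier
  fromℕ zero = 0#
  fromℕ (suc k) = 1# + fromℕ k

  Σ< : ℕ → (ℕ → Carrier) → Carrier
  Σ< zero f = 0#
  Σ< (suc n) f = Σ< n f + f n

  IsChar0Domain : Set (c ⊔ ℓ)
  IsChar0Domain =
    (¬ (1# ≈ 0#)) ×
    (∀ x y → x * y ≈ 0# → (x ≈ 0#) ⊎ (y ≈ 0#)) ×
    (∀ m → ¬ (fromℕ (suc m) ≈ 0#))

  IsPrimRootOfUnity : ℕ → Carrier → Set ℓ
  IsPrimRootOfUnity m z =
    ((z ^ᴿ m) ≈ 1#) × (∀ k → 1 ℕ.≤ k → k ℕ.< m → ¬ ((z ^ᴿ k) ≈ 1#))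

  module Chars (p g : ℕ) (ω ζ : Carrier) where
    -- The multiplicative characters of F_p are χ_j, j = 0 … p-2 (index taken mod p-1):
    -- χ_j (g^k) = ω^(j k), χ_j(0) = 0, where g is a primitive root mod p and
    -- ω a primitive (p-1)-th root of unity.
    chr : ℕ → ℕ → Carrier
    chr j x = Σ< (p ∸ 1) (λ k →
      if ((g ℕ.^ k) mod p) ≡ᵇ (x mod p) then ω ^ᴿ (j ℕ.* k) else 0#)

    -- index arithmetic in the character group: χ_i χ_j = χ_(i+j), χ_j^m = χ_(j m),
    -- inverse character \bar χ_j = χ_((p-2) j) = χ_(-j)
    inv : ℕ → ℕ
    inv j = (p ∸ 2) ℕ.* j

    φi : ℕ
    φi = (p ∸ 1) / 2

    φ : ℕ → Carrier
    φ = chr φi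

    gauss : ℕ → Carrier
    gauss j = Σ< p (λ x → chr j x * (ζ ^ᴿ x))

    module Prop53 (n t : ℕ) where
      nninv : ℕ
      nninv = invMod p (n ℕ.^ n)

      oneMinusN : ℕ
      oneMinusN = (p ℕ.* n ℕ.+ 1 ∸ n) mod p

      α : ℕ
      α = (4 ℕ.* (oneMinusN ℕ.^ (n ∸ 1)) ℕ.* nninv) mod p

      cst : ℕ
      cst = (((n ∸ 1) ℕ.^ (n ∸ 1)) ℕ.* nninv) mod p

      isRoot : ℕ → Bool
      isRoot a = ((a ℕ.^ n ℕ.+ cst ℕ.* t) mod p) ≡ᵇ ((a ℕ.^ (n ∸ 1)) mod p)

      β : Carrier
      β with n DM.% 2
      ... | zero = 1# - (fromℕ (p ∸ 1) * φ (oneMinusN ℕ.* t))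
      ... | suc _ = 1#

      A : Carrier
      A = Σ< (p ∸ 1) (λ j →
            gauss (φi ℕ.+ j ℕ.* (n ∸ 1)) * gauss (inv j ℕ.* n) * gauss (inv j)
            * gauss (j ℕ.* 2) * chr (inv j) (α ℕ.* t))

      RHS : Carrier
      RHS = fromℕ (p ℕ.* (p ∸ 1)) * gauss φi
              * Σ< p (λ a → if isRoot a then φ (a ℕ.* (a ℕ.+ p ∸ 1)) else 0#)
            + fromℕ (p ∸ 1) * gauss φi * β

module Submission where

-- Write χ_j(g^k) = ω^(jk), so that every Gauss sum becomes a sum over discrete logarithms,
-- g(χ_j) = Σ_k ω^(jk) ζ^(g^k).  Expanding the four Gauss sums of A_n(t) and summing over j
-- first, orthogonality keeps only the exponent tuples satisfying one linear congruence
-- modulo p - 1, which eliminates one variable.  The innermost sum is then Σ_v ζ^(c v² + v)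
-- over v ∈ 𝔽ₚ^×; completing the square turns it into φ(c) g(φ) ζ^(-1/(4c)) - 1.  After the
-- substitution k₂ = k₁ + s the sum over k₁ is again an additive character sum, equal to
-- p [M(g^s) = 0] - 1, and M(g^s) = 0 says exactly that a = -g^(-s) is a root of f_t; at such
-- a root the remaining root of unity is φ(a (a - 1)).  What is left, Σ_s φ(g^(sn) α t), is
-- (p - 1) φ((1 - n) t) for even n and 0 for odd n, which produces β_n(t).

open import Defs
open import Level using (Level; _⊔_)
open import Data.Nat as ℕ using (ℕ; zero; suc; _≤_; _<_; z≤n; s≤s; _≡ᵇ_)
import Data.Nat.Properties as ℕₚ
open import Data.Nat.DivMod using (_%_; _/_; m%n<n; m<n⇒m%n≡m; m%n%n≡m%n; m≡m%n+[m/n]*n; %-distribˡ-+; %-distribˡ-*; m*n%n≡0; m*n/n≡m)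
open import Data.Nat.Divisibility using (_∣_; divides; n∣m*n; ∣⇒≤; m%n≡0⇒n∣m; n∣m⇒m%n≡0)
open import Data.Nat.Primality using (Prime; euclidsLemma; prime⇒¬composite; composite-≢; prime⇒nonZero)
open import Data.Nat.Tactic.RingSolver using (solve-∀)
open import Data.Fin as Fin using (Fin)
import Data.Fin.Properties as Finₚ
open import Data.Bool using (Bool; true; false; if_then_else_; not; _∧_)
open import Data.Bool.Properties using (T-≡)
open import Data.Product using (_×_; _,_; proj₁; proj₂; Σ; ∃₂)
open import Data.Sum using (_⊎_; inj₁; inj₂)
open import Data.Empty using (⊥; ⊥-elim)
open import Function.Bundles using (Equivalence)
open import Relation.Nullary using (¬_)
open import Relation.Binary using (Setoid; tri<; tri≈; tri>)
open import Relation.Binary.PropositionalEquality as ≡ using (_≡_; _≢_)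
import Relation.Binary.Reasoning.Setoid as SetoidReasoning
open import Algebra.Bundles using (CommutativeRing; Semiring)
import Algebra.Properties.Group as GroupProperties
import Algebra.Properties.Ring as RingProperties
import Algebra.Properties.Semiring.Mult as SemiringMultProperties
import Algebra.Properties.Semiring.Exp as ExpProperties
import Algebra.Properties.CommutativeSemigroup as CommutativeSemigroupProperties
import Algebra.Solver.CommutativeMonoid as CommutativeMonoidSolver

≡ᵇ⇒≡ : ∀ {a b} → (a ≡ᵇ b) ≡ true → a ≡ b
≡ᵇ⇒≡ {a} {b} e = ℕₚ.≡ᵇ⇒≡ a b (Equivalence.from T-≡ e)

≡⇒≡ᵇ : ∀ {a b} → a ≡ b → (a ≡ᵇ b) ≡ true
≡⇒≡ᵇ {a} {b} e = Equivalence.to T-≡ (ℕₚ.≡⇒≡ᵇ a b e)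

≢⇒≡ᵇ-false : ∀ {a b} → ¬ (a ≡ b) → (a ≡ᵇ b) ≡ false
≢⇒≡ᵇ-false {a} {b} a≢b with a ≡ᵇ b in e
... | true = ⊥-elim (a≢b (≡ᵇ⇒≡ e))
... | false = ≡.refl

module RingSums {r₁ r₂ : Level} (R : CommutativeRing r₁ r₂) where
  open CommutativeRing R
  open InRing R
  open SetoidReasoning setoid
  open RingProperties ring public using (-1*x≈-x; -‿involutive; -‿distribʳ-*; -0#≈0#)
  open import Algebra.Definitions.RawSemiring (Semiring.rawSemiring semiring) using (_^_) renaming (_×_ to _×ᴿ_)
  open CommutativeSemigroupProperties +-commutativeSemigroup using () renaming (interchange to +-interchange)

  x-y≈0⇒x≈y : ∀ {x y} → x - y ≈ 0# → x ≈ y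
  x-y≈0⇒x≈y = GroupProperties.x∙y⁻¹≈ε⇒x≈y +-group _ _

  x+1≈y⇒x≈y-1 : ∀ {x y} → x + 1# ≈ y → x ≈ y - 1#
  x+1≈y⇒x≈y-1 {x} {y} e = begin
    x              ≈⟨ +-identityʳ x ⟨
    x + 0#         ≈⟨ +-congˡ (-‿inverseʳ 1#) ⟨
    x + (1# - 1#)  ≈⟨ +-assoc x 1# (- 1#) ⟨
    (x + 1#) - 1#  ≈⟨ +-congʳ e ⟩
    y - 1#         ∎

  x*-1≈-x : ∀ x → x * - 1# ≈ - x
  x*-1≈-x x = trans (*-comm x (- 1#)) (-1*x≈-x x)

  fromℕ≈×1 : ∀ n → fromℕ n ≈ n ×ᴿ 1#
  fromℕ≈×1 zero = refl
  fromℕ≈×1 (suc n) = +-congˡ (fromℕ≈×1 n)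

  ^ᴿ≈^ : ∀ x n → x ^ᴿ n ≈ x ^ n
  ^ᴿ≈^ x zero = refl
  ^ᴿ≈^ x (suc n) = *-congˡ (^ᴿ≈^ x n)

  fromℕ-homo-* : ∀ a b → fromℕ (a ℕ.* b) ≈ fromℕ a * fromℕ b
  fromℕ-homo-* a b = begin
    fromℕ (a ℕ.* b)          ≈⟨ fromℕ≈×1 (a ℕ.* b) ⟩
    (a ℕ.* b) ×ᴿ 1#          ≈⟨ SemiringMultProperties.×1-homo-* semiring a b ⟩
    (a ×ᴿ 1#) * (b ×ᴿ 1#)    ≈⟨ *-cong (fromℕ≈×1 a) (fromℕ≈×1 b) ⟨
    fromℕ a * fromℕ b        ∎

  ^ᴿ-homo-+ : ∀ x a b → x ^ᴿ (a ℕ.+ b) ≈ x ^ᴿ a * x ^ᴿ b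
  ^ᴿ-homo-+ x a b = begin
    x ^ᴿ (a ℕ.+ b)    ≈⟨ ^ᴿ≈^ x (a ℕ.+ b) ⟩
    x ^ (a ℕ.+ b)     ≈⟨ ExpProperties.^-homo-* semiring x a b ⟩
    x ^ a * x ^ b     ≈⟨ *-cong (^ᴿ≈^ x a) (^ᴿ≈^ x b) ⟨
    x ^ᴿ a * x ^ᴿ b   ∎

  ^ᴿ-assocʳ : ∀ x a b → x ^ᴿ (a ℕ.* b) ≈ (x ^ᴿ a) ^ᴿ b
  ^ᴿ-assocʳ x a b = begin
    x ^ᴿ (a ℕ.* b)    ≈⟨ ^ᴿ≈^ x (a ℕ.* b) ⟩
    x ^ (a ℕ.* b)     ≈⟨ ExpProperties.^-assocʳ semiring x a b ⟨
    (x ^ a) ^ b       ≈⟨ ExpProperties.^-congˡ semiring b (^ᴿ≈^ x a) ⟨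
    (x ^ᴿ a) ^ b      ≈⟨ ^ᴿ≈^ (x ^ᴿ a) b ⟨
    (x ^ᴿ a) ^ᴿ b     ∎

  ^ᴿ-congˡ : ∀ {x y} n → x ≈ y → x ^ᴿ n ≈ y ^ᴿ n
  ^ᴿ-congˡ zero _ = refl
  ^ᴿ-congˡ (suc n) x≈y = *-cong x≈y (^ᴿ-congˡ n x≈y)

  ^ᴿ-congʳ : ∀ x {a b} → a ≡ b → x ^ᴿ a ≈ x ^ᴿ b
  ^ᴿ-congʳ x ≡.refl = refl

  1^ᴿ : ∀ n → 1# ^ᴿ n ≈ 1#
  1^ᴿ zero = refl
  1^ᴿ (suc n) = trans (*-identityˡ _) (1^ᴿ n)

  if-*ˡ : ∀ b a x → a * (if b then x else 0#) ≈ (if b then a * x else 0#)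
  if-*ˡ true a x = refl
  if-*ˡ false a x = zeroʳ a

  if-*ʳ : ∀ b a x → (if b then a else 0#) * x ≈ (if b then a * x else 0#)
  if-*ʳ true a x = refl
  if-*ʳ false a x = zeroˡ x

  Σ<-cong-< : ∀ n {f h : ℕ → Carrier} → (∀ k → k < n → f k ≈ h k) → Σ< n f ≈ Σ< n h
  Σ<-cong-< zero _ = refl
  Σ<-cong-< (suc n) f≈h =
    +-cong (Σ<-cong-< n (λ k k<n → f≈h k (ℕₚ.m<n⇒m<1+n k<n))) (f≈h n ℕₚ.≤-refl)

  Σ<-cong : ∀ n {f h : ℕ → Carrier} → (∀ k → f k ≈ h k) → Σ< n f ≈ Σ< n h
  Σ<-cong n f≈h = Σ<-cong-< n (λ k _ → f≈h k)

  Σ<-length : ∀ {a b} (f : ℕ → Carrier) → a ≡ b → Σ< a f ≈ Σ< b f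
  Σ<-length f ≡.refl = refl

  Σ<-distrib-+ : ∀ n (f h : ℕ → Carrier) → Σ< n (λ k → f k + h k) ≈ Σ< n f + Σ< n h
  Σ<-distrib-+ zero f h = sym (+-identityˡ 0#)
  Σ<-distrib-+ (suc n) f h = begin
    Σ< n (λ k → f k + h k) + (f n + h n)  ≈⟨ +-congʳ (Σ<-distrib-+ n f h) ⟩
    (Σ< n f + Σ< n h) + (f n + h n)       ≈⟨ +-interchange _ _ _ _ ⟩
    (Σ< n f + f n) + (Σ< n h + h n)       ∎

  *-distribˡ-Σ< : ∀ n a (f : ℕ → Carrier) → a * Σ< n f ≈ Σ< n (λ k → a * f k)
  *-distribˡ-Σ< zero a f = zeroʳ a
  *-distribˡ-Σ< (suc n) a f = trans (distribˡ a _ _) (+-congʳ (*-distribˡ-Σ< n a f))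

  *-distribʳ-Σ< : ∀ n a (f : ℕ → Carrier) → Σ< n f * a ≈ Σ< n (λ k → f k * a)
  *-distribʳ-Σ< n a f =
    trans (*-comm _ a) (trans (*-distribˡ-Σ< n a f) (Σ<-cong n (λ k → *-comm a (f k))))

  Σ<-zero : ∀ n → Σ< n (λ _ → 0#) ≈ 0#
  Σ<-zero zero = refl
  Σ<-zero (suc n) = trans (+-identityʳ _) (Σ<-zero n)

  Σ<-vanish : ∀ n (f : ℕ → Carrier) → (∀ k → k < n → f k ≈ 0#) → Σ< n f ≈ 0#
  Σ<-vanish n f f≈0 = trans (Σ<-cong-< n f≈0) (Σ<-zero n)

  Σ<-const : ∀ n a → Σ< n (λ _ → a) ≈ fromℕ n * a
  Σ<-const zero a = sym (zeroˡ a)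
  Σ<-const (suc n) a = begin
    Σ< n (λ _ → a) + a         ≈⟨ +-cong (Σ<-const n a) (sym (*-identityˡ a)) ⟩
    fromℕ n * a + 1# * a       ≈⟨ +-comm _ _ ⟩
    1# * a + fromℕ n * a       ≈⟨ distribʳ a 1# (fromℕ n) ⟨
    (1# + fromℕ n) * a         ∎

  Σ<-neg : ∀ n (f : ℕ → Carrier) → Σ< n (λ k → - f k) ≈ - Σ< n f
  Σ<-neg n f = begin
    Σ< n (λ k → - f k)       ≈⟨ Σ<-cong n (λ k → -1*x≈-x (f k)) ⟨
    Σ< n (λ k → - 1# * f k)  ≈⟨ *-distribˡ-Σ< n (- 1#) f ⟨
    - 1# * Σ< n f            ≈⟨ -1*x≈-x _ ⟩
    - Σ< n f                 ∎

  Σ<-comm : ∀ n m (f : ℕ → ℕ → Carrier) →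
    Σ< n (λ i → Σ< m (λ j → f i j)) ≈ Σ< m (λ j → Σ< n (λ i → f i j))
  Σ<-comm zero m f = sym (Σ<-zero m)
  Σ<-comm (suc n) m f = trans (+-congʳ (Σ<-comm n m f)) (sym (Σ<-distrib-+ m _ _))

  Σ<-split : ∀ a b (f : ℕ → Carrier) → Σ< (a ℕ.+ b) f ≈ Σ< a f + Σ< b (λ i → f (a ℕ.+ i))
  Σ<-split a zero f rewrite ℕₚ.+-identityʳ a = sym (+-identityʳ _)
  Σ<-split a (suc b) f rewrite ℕₚ.+-suc a b =
    trans (+-congʳ (Σ<-split a b f)) (+-assoc _ _ _)

  Σ<-even-odd : ∀ h (f : ℕ → Carrier) →
    Σ< (h ℕ.+ h) f ≈ Σ< h (λ m → f (2 ℕ.* m) + f (suc (2 ℕ.* m)))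
  Σ<-even-odd zero f = refl
  Σ<-even-odd (suc h) f rewrite ℕₚ.+-suc h h = begin
    (Σ< (h ℕ.+ h) f + f (h ℕ.+ h)) + f (suc (h ℕ.+ h))  ≈⟨ +-assoc _ _ _ ⟩
    Σ< (h ℕ.+ h) f + (f (h ℕ.+ h) + f (suc (h ℕ.+ h)))  ≈⟨ +-cong (Σ<-even-odd h f) last-pair ⟩
    Σ< h (λ m → f (2 ℕ.* m) + f (suc (2 ℕ.* m))) + (f (2 ℕ.* h) + f (suc (2 ℕ.* h)))  ∎
    where
    last-pair : f (h ℕ.+ h) + f (suc (h ℕ.+ h)) ≈ f (2 ℕ.* h) + f (suc (2 ℕ.* h))
    last-pair rewrite ℕₚ.+-identityʳ h = refl

  Σ<-select : ∀ n (b : ℕ → Bool) (f : ℕ → Carrier) k → k < n → b k ≡ true →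
    (∀ i → i < n → b i ≡ true → i ≡ k) →
    Σ< n (λ i → if b i then f i else 0#) ≈ f k
  Σ<-select zero b f k () _ _
  Σ<-select (suc n) b f k k<1+n bk unique with ℕₚ.m≤n⇒m<n∨m≡n (ℕₚ.≤-pred k<1+n)
  ... | inj₁ k<n = trans (+-cong (Σ<-select n b f k k<n bk unique-below) last-vanishes) (+-identityʳ _)
    where
    unique-below : ∀ i → i < n → b i ≡ true → i ≡ k
    unique-below i i<n = unique i (ℕₚ.m<n⇒m<1+n i<n)
    last-vanishes : (if b n then f n else 0#) ≈ 0#
    last-vanishes with b n in bn
    ... | true = ⊥-elim (ℕₚ.<-irrefl (≡.sym (unique n ℕₚ.≤-refl bn)) k<n)
    ... | false = refl
  ... | inj₂ ≡.refl = trans (+-cong (Σ<-vanish n _ others-vanish) (reflexive (≡.cong (λ z → if z then f n else 0#) bk)))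
                          (+-identityˡ _)
    where
    others-vanish : ∀ i → i < n → (if b i then f i else 0#) ≈ 0#
    others-vanish i i<n with b i in bi
    ... | true = ⊥-elim (ℕₚ.<-irrefl (unique i (ℕₚ.m<n⇒m<1+n i<n) bi) i<n)
    ... | false = refl

  Σ<-none : ∀ n (b : ℕ → Bool) (f : ℕ → Carrier) → (∀ i → i < n → b i ≡ false) →
    Σ< n (λ i → if b i then f i else 0#) ≈ 0#
  Σ<-none n b f none = Σ<-vanish n _ vanish
    where
    vanish : ∀ i → i < n → (if b i then f i else 0#) ≈ 0#
    vanish i i<n rewrite none i i<n = refl

  Σ<-reindex : ∀ N M (Q P : ℕ → Bool) (σ τ : ℕ → ℕ) (f : ℕ → Carrier) →
    (∀ i → i < N → Q i ≡ true → (σ i < M) × (P (σ i) ≡ true) × (τ (σ i) ≡ i)) →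
    (∀ y → y < M → P y ≡ true → (τ y < N) × (Q (τ y) ≡ true) × (σ (τ y) ≡ y)) →
    Σ< N (λ i → if Q i then f (σ i) else 0#) ≈ Σ< M (λ y → if P y then f y else 0#)
  Σ<-reindex N M Q P σ τ f forward backward = begin
    Σ< N (λ i → if Q i then f (σ i) else 0#)              ≈⟨ Σ<-cong-< N (λ i i<N → sym (expand i i<N)) ⟩
    Σ< N (λ i → Σ< M (λ y → if Q i ∧ hits i y then f y else 0#))  ≈⟨ Σ<-comm N M _ ⟩
    Σ< M (λ y → Σ< N (λ i → if Q i ∧ hits i y then f y else 0#))  ≈⟨ Σ<-cong-< M collapse ⟩
    Σ< M (λ y → if P y then f y else 0#)                   ∎
    where
    hits : ℕ → ℕ → Bool
    hits i y = y ≡ᵇ σ i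

    hit⇒inverse : ∀ i y → i < N → (Q i ∧ hits i y) ≡ true → Q i ≡ true × i ≡ τ y
    hit⇒inverse i y i<N e with Q i in qi | hits i y in hy
    ... | true | true = ≡.refl , ≡.trans (≡.sym (proj₂ (proj₂ (forward i i<N qi)))) (≡.cong τ (≡.sym (≡ᵇ⇒≡ hy)))

    expand : ∀ i → i < N → Σ< M (λ y → if Q i ∧ hits i y then f y else 0#) ≈ (if Q i then f (σ i) else 0#)
    expand i i<N with Q i in qi
    ... | false = Σ<-zero M
    ... | true = Σ<-select M (hits i) f (σ i) (proj₁ (forward i i<N qi)) (≡⇒≡ᵇ {σ i} ≡.refl) (λ y _ e → ≡ᵇ⇒≡ e)

    collapse : ∀ y → y < M → Σ< N (λ i → if Q i ∧ hits i y then f y else 0#) ≈ (if P y then f y else 0#)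
    collapse y y<M with P y in py
    ... | true = Σ<-select N (λ i → Q i ∧ hits i y) (λ _ → f y) (τ y) τy<N hit
                   (λ i i<N e → proj₂ (hit⇒inverse i y i<N e))
      where
      τy<N : τ y < N
      τy<N = proj₁ (backward y y<M py)
      hit : (Q (τ y) ∧ hits (τ y) y) ≡ true
      hit = ≡.cong₂ _∧_ (proj₁ (proj₂ (backward y y<M py)))
                         (≡⇒≡ᵇ (≡.sym (proj₂ (proj₂ (backward y y<M py)))))
    ... | false = Σ<-none N _ _ miss
      where
      miss : ∀ i → i < N → (Q i ∧ hits i y) ≡ false
      miss i i<N with Q i in qi | hits i y in hy
      ... | false | _ = ≡.refl
      ... | true | false = ≡.refl
      ... | true | true
        with ≡.trans (≡.sym (proj₁ (proj₂ (forward i i<N qi)))) (≡.trans (≡.cong P (≡.sym (≡ᵇ⇒≡ hy))) py)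
      ...   | ()

  Σ<-permute : ∀ N (σ τ : ℕ → ℕ) (f : ℕ → Carrier) →
    (∀ i → i < N → (σ i < N) × (τ (σ i) ≡ i)) →
    (∀ y → y < N → (τ y < N) × (σ (τ y) ≡ y)) →
    Σ< N (λ i → f (σ i)) ≈ Σ< N f
  Σ<-permute N σ τ f forward backward =
    Σ<-reindex N N (λ _ → true) (λ _ → true) σ τ f
      (λ i i<N _ → proj₁ (forward i i<N) , ≡.refl , proj₂ (forward i i<N))
      (λ y y<N _ → proj₁ (backward y y<N) , ≡.refl , proj₂ (backward y y<N))

^-distribʳ-* : ∀ a b k → (a ℕ.* b) ℕ.^ k ≡ a ℕ.^ k ℕ.* b ℕ.^ k
^-distribʳ-* a b zero = ≡.refl
^-distribʳ-* a b (suc k) = ≡.trans (≡.cong ((a ℕ.* b) ℕ.*_) (^-distribʳ-* a b k)) (interchange a b (a ℕ.^ k) (b ℕ.^ k))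
  where
  interchange : ∀ a b c d → (a ℕ.* b) ℕ.* (c ℕ.* d) ≡ (a ℕ.* c) ℕ.* (b ℕ.* d)
  interchange = solve-∀

div-mod-2 : ∀ m {r k} → m % 2 ≡ r → m / 2 ≡ k → m ≡ r ℕ.+ 2 ℕ.* k
div-mod-2 m ≡.refl ≡.refl = ≡.trans (m≡m%n+[m/n]*n m 2) (≡.cong (m % 2 ℕ.+_) (ℕₚ.*-comm (m / 2) 2))

-- The largest i < n with b i, or 0 if there is none.
findBelow : ℕ → (ℕ → Bool) → ℕ
findBelow zero b = 0
findBelow (suc n) b = if b n then n else findBelow n b

findBelow-spec : ∀ n b → (findBelow n b < n × b (findBelow n b) ≡ true) ⊎ (∀ i → i < n → b i ≡ false)
findBelow-spec zero b = inj₂ (λ i ())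
findBelow-spec (suc n) b with b n in bn
... | true = inj₁ (ℕₚ.≤-refl , bn)
... | false with findBelow-spec n b
...   | inj₁ (found<n , found) = inj₁ (ℕₚ.m<n⇒m<1+n found<n , found)
...   | inj₂ none = inj₂ none-below
  where
  none-below : ∀ i → i < suc n → b i ≡ false
  none-below i i<1+n with ℕₚ.m≤n⇒m<n∨m≡n (ℕₚ.≤-pred i<1+n)
  ... | inj₁ i<n = none i i<n
  ... | inj₂ ≡.refl = bn

injective⇒surjective-below : ∀ n (f : ℕ → ℕ) → (∀ i → i < n → f i < n) →
  (∀ i j → i < j → j < n → f i ≡ f j → ⊥) →
  ∀ y → y < n → Σ ℕ (λ i → i < n × f i ≡ y)
injective⇒surjective-below zero f _ _ y ()
injective⇒surjective-below (suc n) f f<n injective y y<n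
  with findBelow-spec (suc n) (λ i → f i ≡ᵇ y)
... | inj₁ (i<n , fi≡y) = _ , i<n , ≡ᵇ⇒≡ fi≡y
-- Otherwise f maps into Fin (suc n) minus y, and two points must collide.
... | inj₂ missed = ⊥-elim (collision (Finₚ.pigeonhole (ℕₚ.n<1+n n) (λ i → Fin.punchOut (Y≢F i))))
  where
  Y : Fin (suc n)
  Y = Fin.fromℕ< y<n
  F : Fin (suc n) → Fin (suc n)
  F i = Fin.fromℕ< (f<n (Fin.toℕ i) (Finₚ.toℕ<n i))
  Y≢F : ∀ i → ¬ (Y ≡ F i)
  Y≢F i Y≡Fi with ≡.trans (≡.sym (≡⇒≡ᵇ y≡fi)) (missed (Fin.toℕ i) (Finₚ.toℕ<n i))
    where
    y≡fi : f (Fin.toℕ i) ≡ y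
    y≡fi = ≡.sym (≡.trans (≡.sym (Finₚ.toℕ-fromℕ< y<n)) (≡.trans (≡.cong Fin.toℕ Y≡Fi) (Finₚ.toℕ-fromℕ< _)))
  ... | ()
  collision : ∃₂ (λ i j → i Fin.< j × Fin.punchOut (Y≢F i) ≡ Fin.punchOut (Y≢F j)) → ⊥
  collision (i , j , i<j , e) = injective (Fin.toℕ i) (Fin.toℕ j) i<j (Finₚ.toℕ<n j) fi≡fj
    where
    fi≡fj : f (Fin.toℕ i) ≡ f (Fin.toℕ j)
    fi≡fj = ≡.trans (≡.sym (Finₚ.toℕ-fromℕ< _))
              (≡.trans (≡.cong Fin.toℕ (Finₚ.punchOut-injective (Y≢F i) (Y≢F j) e)) (Finₚ.toℕ-fromℕ< _))

module Congruence (k : ℕ) where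
  open import Data.Nat using (_+_; _*_; _^_; _∸_)

  m : ℕ
  m = suc k

  infix 4 _≋_
  record _≋_ (x y : ℕ) : Set where
    constructor mk≋
    field un≋ : x % m ≡ y % m
  open _≋_ public

  ≋-refl : ∀ {x} → x ≋ x
  ≋-refl = mk≋ ≡.refl

  ≋-sym : ∀ {x y} → x ≋ y → y ≋ x
  ≋-sym (mk≋ e) = mk≋ (≡.sym e)

  ≋-trans : ∀ {x y z} → x ≋ y → y ≋ z → x ≋ z
  ≋-trans (mk≋ e) (mk≋ f) = mk≋ (≡.trans e f)

  ≡⇒≋ : ∀ {x y} → x ≡ y → x ≋ y
  ≡⇒≋ ≡.refl = ≋-refl

  ≋-setoid : Setoid _ _
  ≋-setoid = record { Carrier = ℕ ; _≈_ = _≋_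
                    ; isEquivalence = record { refl = ≋-refl ; sym = ≋-sym ; trans = ≋-trans } }

  %≋ : ∀ x → x % m ≋ x
  %≋ x = mk≋ (m%n%n≡m%n x m)

  +≋ : ∀ {a b c d} → a ≋ b → c ≋ d → a + c ≋ b + d
  +≋ {a} {b} {c} {d} (mk≋ e₁) (mk≋ e₂) = mk≋ (≡.trans (%-distribˡ-+ a c m)
    (≡.trans (≡.cong₂ (λ u v → (u + v) % m) e₁ e₂) (≡.sym (%-distribˡ-+ b d m))))

  *≋ : ∀ {a b c d} → a ≋ b → c ≋ d → a * c ≋ b * d
  *≋ {a} {b} {c} {d} (mk≋ e₁) (mk≋ e₂) = mk≋ (≡.trans (%-distribˡ-* a c m)
    (≡.trans (≡.cong₂ (λ u v → (u * v) % m) e₁ e₂) (≡.sym (%-distribˡ-* b d m))))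

  ^≋ : ∀ {a b} j → a ≋ b → a ^ j ≋ b ^ j
  ^≋ zero _ = ≋-refl
  ^≋ (suc j) a≋b = *≋ a≋b (^≋ j a≋b)

  +≋ˡ : ∀ {a b} c → a ≋ b → c + a ≋ c + b
  +≋ˡ c = +≋ (≋-refl {c})

  +≋ʳ : ∀ {a b} c → a ≋ b → a + c ≋ b + c
  +≋ʳ c a≋b = +≋ a≋b (≋-refl {c})

  *≋ˡ : ∀ {a b} c → a ≋ b → c * a ≋ c * b
  *≋ˡ c = *≋ (≋-refl {c})

  *≋ʳ : ∀ {a b} c → a ≋ b → a * c ≋ b * c
  *≋ʳ c a≋b = *≋ a≋b (≋-refl {c})

  multiple≋0 : ∀ j → j * m ≋ 0
  multiple≋0 j = mk≋ (m*n%n≡0 j m)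

  +multiple≋ : ∀ x j → x + j * m ≋ x
  +multiple≋ x j = ≋-trans (+≋ˡ x (multiple≋0 j)) (≡⇒≋ (ℕₚ.+-identityʳ x))

  +-cancelʳ-≋ : ∀ {a b} x → a + x ≋ b + x → a ≋ b
  +-cancelʳ-≋ {a} {b} x a+x≋b+x = begin
    a                ≈⟨ +multiple≋ a x ⟨
    a + x * m        ≡⟨ regroup a x k ⟩
    a + x + k * x    ≈⟨ +≋ʳ (k * x) a+x≋b+x ⟩
    b + x + k * x    ≡⟨ regroup b x k ⟨
    b + x * m        ≈⟨ +multiple≋ b x ⟩
    b                ∎
    where
    open SetoidReasoning ≋-setoid
    regroup : ∀ a x k → a + x * suc k ≡ a + x + k * x
    regroup = solve-∀

  ≋⇒≡-below : ∀ {x y} → x < m → y < m → x ≋ y → x ≡ y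
  ≋⇒≡-below {x} {y} x<m y<m (mk≋ e) = ≡.trans (≡.sym (m<n⇒m%n≡m x<m)) (≡.trans e (m<n⇒m%n≡m y<m))

  ≋0⇒∣ : ∀ {x} → x ≋ 0 → m ∣ x
  ≋0⇒∣ {x} (mk≋ e) = m%n≡0⇒n∣m x m e

  ∣⇒≋0 : ∀ {x} → m ∣ x → x ≋ 0
  ∣⇒≋0 {x} m∣x = mk≋ (n∣m⇒m%n≡0 x m m∣x)

  ≋⇒∣∸ : ∀ {x y} → x ≋ y → m ∣ y ∸ x
  ≋⇒∣∸ {x} {y} (mk≋ e) = ≡.subst (m ∣_) (≡.sym y∸x≡) (n∣m*n (y / m ∸ x / m))
    where
    open ≡.≡-Reasoning
    y∸x≡ : y ∸ x ≡ (y / m ∸ x / m) * m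
    y∸x≡ = begin
      y ∸ x                                    ≡⟨ ≡.cong₂ _∸_ (m≡m%n+[m/n]*n y m) (m≡m%n+[m/n]*n x m) ⟩
      (y % m + y / m * m) ∸ (x % m + x / m * m) ≡⟨ ≡.cong (λ z → (y % m + y / m * m) ∸ (z + x / m * m)) e ⟩
      (y % m + y / m * m) ∸ (y % m + x / m * m) ≡⟨ ℕₚ.[m+n]∸[m+o]≡n∸o (y % m) _ _ ⟩
      y / m * m ∸ x / m * m                    ≡⟨ ℕₚ.*-distribʳ-∸ m (y / m) (x / m) ⟨
      (y / m ∸ x / m) * m                      ∎

  Unit : ℕ → Set
  Unit x = ¬ (x ≋ 0)

  unit-resp-≋ : ∀ {a b} → a ≋ b → Unit a → Unit b
  unit-resp-≋ a≋b ua b≋0 = ua (≋-trans a≋b b≋0)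

module PrimeField (k : ℕ) (prime : Prime (suc (suc k))) where
  open import Data.Nat using (_+_; _*_; _^_; _∸_)
  open Congruence (suc k) public

  private
    cancel-ordered : ∀ {a b c} → a < m → b < m → a ≤ b → a * c ≋ b * c → Unit c → a ≡ b
    cancel-ordered {a} {b} {c} a<m b<m a≤b ac≋bc uc
      with euclidsLemma (b ∸ a) c prime (≡.subst (m ∣_) (≡.sym (ℕₚ.*-distribʳ-∸ c b a)) (≋⇒∣∸ ac≋bc))
    ... | inj₂ m∣c = ⊥-elim (uc (∣⇒≋0 m∣c))
    ... | inj₁ m∣b∸a = ℕₚ.≤-antisym a≤b (ℕₚ.m∸n≡0⇒m≤n (small-multiple m∣b∸a (ℕₚ.≤-<-trans (ℕₚ.m∸n≤m b a) b<m)))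
      where
      small-multiple : ∀ {x} → m ∣ x → x < m → x ≡ 0
      small-multiple {zero} _ _ = ≡.refl
      small-multiple {suc x} m∣x x<m = ⊥-elim (ℕₚ.<⇒≱ x<m (∣⇒≤ m∣x))

  cancelʳ : ∀ {a b c} → a * c ≋ b * c → Unit c → a ≋ b
  cancelʳ {a} {b} {c} ac≋bc uc with ℕₚ.≤-total (a % m) (b % m)
  ... | inj₁ le = mk≋ (cancel-ordered (m%n<n a m) (m%n<n b m) le reduced uc)
    where
    reduced : a % m * c ≋ b % m * c
    reduced = ≋-trans (*≋ʳ c (%≋ a)) (≋-trans ac≋bc (*≋ʳ c (≋-sym (%≋ b))))
  ... | inj₂ le = mk≋ (≡.sym (cancel-ordered (m%n<n b m) (m%n<n a m) le reduced uc))
    where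
    reduced : b % m * c ≋ a % m * c
    reduced = ≋-trans (*≋ʳ c (%≋ b)) (≋-trans (≋-sym ac≋bc) (*≋ʳ c (≋-sym (%≋ a))))


  cancelˡ : ∀ {a b c} → c * a ≋ c * b → Unit c → a ≋ b
  cancelˡ {a} {b} {c} ca≋cb =
    cancelʳ (≋-trans (≡⇒≋ (ℕₚ.*-comm a c)) (≋-trans ca≋cb (≡⇒≋ (ℕₚ.*-comm c b))))

  unit-* : ∀ {a b} → Unit a → Unit b → Unit (a * b)
  unit-* {a} {b} ua ub ab≋0 with euclidsLemma a b prime (≋0⇒∣ ab≋0)
  ... | inj₁ m∣a = ua (∣⇒≋0 m∣a)
  ... | inj₂ m∣b = ub (∣⇒≋0 m∣b)

  unit-^ : ∀ {a} j → Unit a → Unit (a ^ j)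
  unit-^ zero ua (mk≋ ())
  unit-^ (suc j) ua = unit-* ua (unit-^ j ua)

module DiscreteLog (q g : ℕ) (prime : Prime (3 ℕ.+ 2 ℕ.* q)) (g-primitive : IsPrimitiveRoot (3 ℕ.+ 2 ℕ.* q) g) where
  open import Data.Nat using (_+_; _*_; _^_; _∸_)

  p N : ℕ
  p = 3 + 2 * q
  N = 2 + 2 * q

  module 𝔽ₚ = PrimeField (suc (2 * q)) prime
  module ℤₙ = Congruence (suc (2 * q))
  open 𝔽ₚ using (_≋_; mk≋; un≋; ≋-refl; ≋-sym; ≋-trans; ≡⇒≋; Unit)
  open SetoidReasoning 𝔽ₚ.≋-setoid

  g^-unit : ∀ k → Unit (g ^ k)
  g^-unit k = 𝔽ₚ.unit-^ k (λ g≋0 → proj₁ g-primitive (un≋ g≋0))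

  g^-distinct : ∀ i j → i < j → j ∸ i < N → g ^ i ≋ g ^ j → ⊥
  g^-distinct i j i<j j∸i<N gⁱ≋gʲ =
    proj₂ g-primitive (j ∸ i) (ℕₚ.m<n⇒0<n∸m i<j) j∸i<N (un≋ (≋-sym gʲ⁻ⁱ≋1))
    where
    gʲ≡ : g ^ j ≡ g ^ i * g ^ (j ∸ i)
    gʲ≡ = ≡.trans (≡.cong (g ^_) (≡.sym (ℕₚ.m+[n∸m]≡n (ℕₚ.<⇒≤ i<j)))) (ℕₚ.^-distribˡ-+-* g i (j ∸ i))
    gʲ⁻ⁱ≋1 : 1 ≋ g ^ (j ∸ i)
    gʲ⁻ⁱ≋1 = 𝔽ₚ.cancelˡ (≋-trans (≡⇒≋ (ℕₚ.*-identityʳ _)) (≋-trans gⁱ≋gʲ (≡⇒≋ gʲ≡))) (g^-unit i)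

  private
    below : ∀ i {j} → j < N → j ∸ i < N
    below i {j} j<N = ℕₚ.≤-<-trans (ℕₚ.m∸n≤m j i) j<N

    residue-injective : ∀ {x y} → Unit x → Unit y → ℕ.pred (x % p) ≡ ℕ.pred (y % p) → x ≋ y
    residue-injective ux uy e =
      mk≋ (ℕₚ.pred-injective {{ℕ.≢-nonZero (λ e → ux (mk≋ e))}} {{ℕ.≢-nonZero (λ e → uy (mk≋ e))}} e)

    residue-bounded : ∀ x → ℕ.pred (x % p) < N
    residue-bounded x = ℕₚ.m<n+o⇒m∸n<o (x % p) 1 (m%n<n x p)

  g^-surjective : ∀ y → Unit y → Σ ℕ (λ k → k < N × g ^ k ≋ y)
  g^-surjective y uy with injective⇒surjective-below N (λ k → ℕ.pred (g ^ k % p))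
                            (λ k _ → residue-bounded (g ^ k)) injective (ℕ.pred (y % p)) (residue-bounded y)
    where
    injective : ∀ i j → i < j → j < N → ℕ.pred (g ^ i % p) ≡ ℕ.pred (g ^ j % p) → ⊥
    injective i j i<j j<N e = g^-distinct i j i<j (below i j<N) (residue-injective (g^-unit i) (g^-unit j) e)
  ... | k , k<N , e = k , k<N , residue-injective (g^-unit k) uy e

  g^N≋1 : g ^ N ≋ 1
  g^N≋1 with g^-surjective (g ^ N) (g^-unit N)
  ... | zero , _ , e = ≋-sym e
  ... | suc k , k<N , e = ⊥-elim (g^-distinct (suc k) N k<N (s≤s (ℕₚ.m∸n≤m (suc (2 * q)) k)) e)

  g^-multiple≋1 : ∀ j → g ^ (j * N) ≋ 1
  g^-multiple≋1 j = begin
    g ^ (j * N)    ≡⟨ ≡.trans (≡.cong (g ^_) (ℕₚ.*-comm j N)) (≡.sym (ℕₚ.^-*-assoc g N j)) ⟩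
    (g ^ N) ^ j    ≈⟨ 𝔽ₚ.^≋ j g^N≋1 ⟩
    1 ^ j          ≡⟨ ℕₚ.^-zeroˡ j ⟩
    1              ∎

  g^-reduce : ∀ a → g ^ a ≋ g ^ (a % N)
  g^-reduce a = begin
    g ^ a                          ≡⟨ ≡.cong (g ^_) (m≡m%n+[m/n]*n a N) ⟩
    g ^ (a % N + a / N * N)        ≡⟨ ℕₚ.^-distribˡ-+-* g (a % N) _ ⟩
    g ^ (a % N) * g ^ (a / N * N)  ≈⟨ 𝔽ₚ.*≋ˡ (g ^ (a % N)) (g^-multiple≋1 (a / N)) ⟩
    g ^ (a % N) * 1                ≡⟨ ℕₚ.*-identityʳ _ ⟩
    g ^ (a % N)                    ∎

  g^-injective : ∀ {a b} → g ^ a ≋ g ^ b → a ℤₙ.≋ b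
  g^-injective {a} {b} e with ℕₚ.<-cmp (a % N) (b % N)
  ... | tri< lt _ _ = ⊥-elim (g^-distinct (a % N) (b % N) lt (below (a % N) (m%n<n b N))
                        (≋-trans (≋-sym (g^-reduce a)) (≋-trans e (g^-reduce b))))
  ... | tri≈ _ eq _ = ℤₙ.mk≋ eq
  ... | tri> _ _ gt = ⊥-elim (g^-distinct (b % N) (a % N) gt (below (b % N) (m%n<n a N))
                        (≋-trans (≋-sym (g^-reduce b)) (≋-trans (≋-sym e) (g^-reduce a))))

  g^-cong : ∀ {a b} → a ℤₙ.≋ b → g ^ a ≋ g ^ b
  g^-cong {a} {b} (ℤₙ.mk≋ e) = ≋-trans (g^-reduce a) (≋-trans (≡⇒≋ (≡.cong (g ^_) e)) (≋-sym (g^-reduce b)))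

  log : ℕ → ℕ
  log y = findBelow N (λ k → (g ^ k % p) ≡ᵇ (y % p))

  log-spec : ∀ y → Unit y → log y < N × g ^ log y ≋ y
  log-spec y uy with findBelow-spec N (λ k → (g ^ k % p) ≡ᵇ (y % p))
  ... | inj₁ (lt , found) = lt , mk≋ (≡ᵇ⇒≡ found)
  ... | inj₂ none with g^-surjective y uy
  ...   | k , k<N , mk≋ e with ≡.trans (≡.sym (≡⇒≡ᵇ e)) (none k k<N)
  ...     | ()

  g^log : ∀ {y} → Unit y → g ^ log y ≋ y
  g^log {y} uy = proj₂ (log-spec y uy)

  log-unique : ∀ {y} k → k < N → g ^ k ≋ y → log y ≡ k
  log-unique {y} k k<N gᵏ≋y =
    ℤₙ.≋⇒≡-below (proj₁ (log-spec y y-unit)) k<N (g^-injective (≋-trans (g^log y-unit) (≋-sym gᵏ≋y)))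
    where
    y-unit : Unit y
    y-unit = 𝔽ₚ.unit-resp-≋ gᵏ≋y (g^-unit k)

  log-≋ : ∀ {y} e → g ^ e ≋ y → log y ℤₙ.≋ e
  log-≋ {y} e gᵉ≋y =
    ℤₙ.≋-trans (ℤₙ.≡⇒≋ (log-unique (e % N) (m%n<n e N) (≋-trans (≋-sym (g^-reduce e)) gᵉ≋y))) (ℤₙ.%≋ e)

  fermat : ∀ x → Unit x → x ^ N ≋ 1
  fermat x ux = begin
    x ^ N              ≈⟨ 𝔽ₚ.^≋ N (g^log ux) ⟨
    (g ^ log x) ^ N    ≡⟨ ℕₚ.^-*-assoc g (log x) N ⟩
    g ^ (log x * N)    ≈⟨ g^-multiple≋1 (log x) ⟩
    1                  ∎

  recip : ℕ → ℕ
  recip x = x ^ (1 + 2 * q)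

  *-recip : ∀ {x} → Unit x → x * recip x ≋ 1
  *-recip {x} = fermat x

  minus-one : ℕ
  minus-one = 2 + 2 * q

  negate : ℕ → ℕ
  negate x = minus-one * x

  negate-+ : ∀ x → negate x + x ≋ 0
  negate-+ x = ≋-trans (≡⇒≋ (regroup q x)) (𝔽ₚ.multiple≋0 x)
    where
    regroup : ∀ q x → (2 + 2 * q) * x + x ≡ x * (3 + 2 * q)
    regroup = solve-∀

NoZeroDivisors : ∀ {r₁ r₂} → CommutativeRing r₁ r₂ → Set (r₁ ⊔ r₂)
NoZeroDivisors R = ∀ x y → x * y ≈ 0# → x ≈ 0# ⊎ y ≈ 0#
  where open CommutativeRing R

module RootsOfUnity {r₁ r₂ : Level} (R : CommutativeRing r₁ r₂)
  (no-zero-divisors : NoZeroDivisors R) where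
  open CommutativeRing R
  open InRing R
  open RingSums R
  open SetoidReasoning setoid
  open CommutativeSemigroupProperties +-commutativeSemigroup using (xy∙z≈xz∙y)

  cancel-nonzero : ∀ {x y} → ¬ (x ≈ 0#) → x * y ≈ 0# → y ≈ 0#
  cancel-nonzero {x} {y} x≉0 xy≈0 with no-zero-divisors x y xy≈0
  ... | inj₁ x≈0 = ⊥-elim (x≉0 x≈0)
  ... | inj₂ y≈0 = y≈0

  geometric-sum : ∀ z n → z * Σ< n (z ^ᴿ_) + 1# ≈ Σ< n (z ^ᴿ_) + z ^ᴿ n
  geometric-sum z zero = trans (+-congʳ (zeroʳ z)) (trans (+-identityˡ _) (sym (+-identityˡ _)))
  geometric-sum z (suc n) = begin
    z * (S + z ^ᴿ n) + 1#        ≈⟨ +-congʳ (distribˡ z S (z ^ᴿ n)) ⟩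
    (z * S + z ^ᴿ suc n) + 1#    ≈⟨ xy∙z≈xz∙y _ _ _ ⟩
    (z * S + 1#) + z ^ᴿ suc n    ≈⟨ +-congʳ (geometric-sum z n) ⟩
    (S + z ^ᴿ n) + z ^ᴿ suc n    ∎
    where
    S : Carrier
    S = Σ< n (z ^ᴿ_)

  geometric-sum-vanishes : ∀ z n → z ^ᴿ n ≈ 1# → ¬ (z ≈ 1#) → Σ< n (z ^ᴿ_) ≈ 0#
  geometric-sum-vanishes z n zⁿ≈1 z≉1 = cancel-nonzero (λ e → z≉1 (x-y≈0⇒x≈y e)) (begin
    (z - 1#) * S          ≈⟨ distribʳ S z (- 1#) ⟩
    z * S + - 1# * S      ≈⟨ +-cong zS≈S (-1*x≈-x S) ⟩
    S - S                 ≈⟨ -‿inverseʳ S ⟩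
    0#                    ∎)
    where
    S : Carrier
    S = Σ< n (z ^ᴿ_)
    zS≈S : z * S ≈ S
    zS≈S = trans (x+1≈y⇒x≈y-1 (trans (geometric-sum z n) (+-congˡ zⁿ≈1))) (begin
      (S + 1#) - 1#   ≈⟨ +-assoc S 1# (- 1#) ⟩
      S + (1# - 1#)   ≈⟨ +-congˡ (-‿inverseʳ 1#) ⟩
      S + 0#          ≈⟨ +-identityʳ S ⟩
      S               ∎)

  x²≈1⇒x≈-1 : ∀ {x} → x * x ≈ 1# → ¬ (x ≈ 1#) → x ≈ - 1#
  x²≈1⇒x≈-1 {x} x²≈1 x≉1 =
    x-y≈0⇒x≈y (trans (+-congˡ (-‿involutive 1#)) (cancel-nonzero (λ e → x≉1 (x-y≈0⇒x≈y e)) (begin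
      (x - 1#) * (x + 1#)              ≈⟨ distribʳ (x + 1#) x (- 1#) ⟩
      x * (x + 1#) + - 1# * (x + 1#)   ≈⟨ +-cong (distribˡ x x 1#) (-1*x≈-x _) ⟩
      (x * x + x * 1#) - (x + 1#)      ≈⟨ +-congʳ (+-cong x²≈1 (*-identityʳ x)) ⟩
      (1# + x) - (x + 1#)              ≈⟨ +-congʳ (+-comm 1# x) ⟩
      (x + 1#) - (x + 1#)              ≈⟨ -‿inverseʳ _ ⟩
      0#                               ∎)))

  module Primitive (k : ℕ) (z : Carrier) (z-primitive : IsPrimRootOfUnity (suc k) z) where
    M : ℕ
    M = suc k
    module ℤₘ = Congruence k

    z^-multiple≈1 : ∀ j → z ^ᴿ (j ℕ.* M) ≈ 1#
    z^-multiple≈1 j = begin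
      z ^ᴿ (j ℕ.* M)    ≈⟨ ^ᴿ-congʳ z (ℕₚ.*-comm j M) ⟩
      z ^ᴿ (M ℕ.* j)    ≈⟨ ^ᴿ-assocʳ z M j ⟩
      (z ^ᴿ M) ^ᴿ j     ≈⟨ ^ᴿ-congˡ j (proj₁ z-primitive) ⟩
      1# ^ᴿ j           ≈⟨ 1^ᴿ j ⟩
      1#                ∎

    z^-reduce : ∀ a → z ^ᴿ a ≈ z ^ᴿ (a % M)
    z^-reduce a = begin
      z ^ᴿ a                                ≈⟨ ^ᴿ-congʳ z (m≡m%n+[m/n]*n a M) ⟩
      z ^ᴿ (a % M ℕ.+ a / M ℕ.* M)          ≈⟨ ^ᴿ-homo-+ z (a % M) _ ⟩
      z ^ᴿ (a % M) * z ^ᴿ (a / M ℕ.* M)     ≈⟨ *-congˡ (z^-multiple≈1 (a / M)) ⟩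
      z ^ᴿ (a % M) * 1#                     ≈⟨ *-identityʳ _ ⟩
      z ^ᴿ (a % M)                          ∎

    z^-cong : ∀ {a b} → a ℤₘ.≋ b → z ^ᴿ a ≈ z ^ᴿ b
    z^-cong {a} {b} (ℤₘ.mk≋ e) = trans (z^-reduce a) (trans (^ᴿ-congʳ z e) (sym (z^-reduce b)))

    orthogonality : ∀ e → Σ< M (λ j → z ^ᴿ (j ℕ.* e)) ≈ (if e % M ≡ᵇ 0 then fromℕ M else 0#)
    orthogonality e = trans (Σ<-cong M (λ j → trans (^ᴿ-congʳ z (ℕₚ.*-comm j e)) (^ᴿ-assocʳ z e j)))
                            (by-residue (e % M) ≡.refl)
      where
      by-residue : ∀ r → e % M ≡ r → Σ< M ((z ^ᴿ e) ^ᴿ_) ≈ (if r ≡ᵇ 0 then fromℕ M else 0#)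
      by-residue zero e%M≡0 = begin
        Σ< M ((z ^ᴿ e) ^ᴿ_)   ≈⟨ Σ<-cong M (λ j → trans (^ᴿ-congˡ j zᵉ≈1) (1^ᴿ j)) ⟩
        Σ< M (λ _ → 1#)       ≈⟨ Σ<-const M 1# ⟩
        fromℕ M * 1#          ≈⟨ *-identityʳ _ ⟩
        fromℕ M               ∎
        where
        zᵉ≈1 : z ^ᴿ e ≈ 1#
        zᵉ≈1 = trans (z^-reduce e) (^ᴿ-congʳ z e%M≡0)
      by-residue (suc r) e%M≡1+r = geometric-sum-vanishes (z ^ᴿ e) M zᵉᴹ≈1 zᵉ≉1
        where
        zᵉᴹ≈1 : (z ^ᴿ e) ^ᴿ M ≈ 1#
        zᵉᴹ≈1 = trans (sym (^ᴿ-assocʳ z e M)) (z^-multiple≈1 e)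
        zᵉ≉1 : ¬ (z ^ᴿ e ≈ 1#)
        zᵉ≉1 zᵉ≈1 = proj₂ z-primitive (suc r) (s≤s z≤n) (≡.subst (_< M) e%M≡1+r (m%n<n e M))
                      (trans (sym (^ᴿ-congʳ z e%M≡1+r)) (trans (sym (z^-reduce e)) zᵉ≈1))

module AffineSubstitution {r₁ r₂ : Level} (R : CommutativeRing r₁ r₂) (k : ℕ) where
  open CommutativeRing R using (Carrier; _≈_)
  open InRing R
  open RingSums R
  open Congruence k
  open SetoidReasoning ≋-setoid
  open import Data.Nat using (_+_; _*_)

  Σ<-affine : ∀ a a′ b → a * a′ ≋ 1 → (F : ℕ → Carrier) → Σ< m (λ v → F ((a * v + b) % m)) ≈ Σ< m F
  Σ<-affine a a′ b aa′≋1 F = Σ<-permute m σ τ F forward backward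
    where
    σ τ : ℕ → ℕ
    σ v = (a * v + b) % m
    τ y = ((y + k * b) * a′) % m
    forward : ∀ v → v < m → σ v < m × τ (σ v) ≡ v
    forward v v<m = m%n<n (a * v + b) m , ≋⇒≡-below (m%n<n ((σ v + k * b) * a′) m) v<m (begin
      τ (σ v)                          ≈⟨ %≋ ((σ v + k * b) * a′) ⟩
      (σ v + k * b) * a′               ≈⟨ *≋ʳ a′ (+≋ʳ (k * b) (%≋ (a * v + b))) ⟩
      (a * v + b + k * b) * a′         ≡⟨ regroup a v b k a′ ⟩
      v * (a * a′) + (b * a′) * m      ≈⟨ +multiple≋ _ (b * a′) ⟩
      v * (a * a′)                     ≈⟨ *≋ˡ v aa′≋1 ⟩
      v * 1                            ≡⟨ ℕₚ.*-identityʳ v ⟩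
      v                                ∎)
      where
      regroup : ∀ a v b k a′ → (a * v + b + k * b) * a′ ≡ v * (a * a′) + (b * a′) * suc k
      regroup = solve-∀
    backward : ∀ y → y < m → τ y < m × σ (τ y) ≡ y
    backward y y<m = m%n<n ((y + k * b) * a′) m , ≋⇒≡-below (m%n<n (a * τ y + b) m) y<m (begin
      σ (τ y)                          ≈⟨ %≋ (a * τ y + b) ⟩
      a * τ y + b                      ≈⟨ +≋ʳ b (*≋ˡ a (%≋ ((y + k * b) * a′))) ⟩
      a * ((y + k * b) * a′) + b       ≡⟨ regroup a y b k a′ ⟩
      (y + k * b) * (a * a′) + b       ≈⟨ +≋ʳ b (*≋ˡ (y + k * b) aa′≋1) ⟩
      (y + k * b) * 1 + b              ≡⟨ regroup′ y k b ⟩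
      y + b * m                        ≈⟨ +multiple≋ y b ⟩
      y                                ∎)
      where
      regroup : ∀ a y b k a′ → a * ((y + k * b) * a′) + b ≡ (y + k * b) * (a * a′) + b
      regroup = solve-∀
      regroup′ : ∀ y k b → (y + k * b) * 1 + b ≡ y + b * suc k
      regroup′ = solve-∀

-- The odd prime is written p = 2q + 3, so that p - 1 = 2h with h = q + 1.
module CharacterSums {r₁ r₂ : Level} (R : CommutativeRing r₁ r₂)
  (no-zero-divisors : NoZeroDivisors R)
  (q g : ℕ) (ω ζ : CommutativeRing.Carrier R)
  (prime : Prime (3 ℕ.+ 2 ℕ.* q)) (g-primitive : IsPrimitiveRoot (3 ℕ.+ 2 ℕ.* q) g)
  (ω-primitive : InRing.IsPrimRootOfUnity R (2 ℕ.+ 2 ℕ.* q) ω)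
  (ζ-primitive : InRing.IsPrimRootOfUnity R (3 ℕ.+ 2 ℕ.* q) ζ) where
  open CommutativeRing R
  open InRing R
  open RingSums R public
  open RootsOfUnity R no-zero-divisors public
  open DiscreteLog q g prime g-primitive public
  open 𝔽ₚ using (_≋_; mk≋; un≋; ≋-refl; ≋-sym; ≋-trans; ≡⇒≋; Unit)
  open Chars p g ω ζ public
  open SetoidReasoning setoid
  open CommutativeSemigroupProperties +-commutativeSemigroup using (xy∙z≈xz∙y)
  module 𝔽-Reasoning = SetoidReasoning 𝔽ₚ.≋-setoid
  module ℤₙ-Reasoning = SetoidReasoning ℤₙ.≋-setoid

  h : ℕ
  h = suc q

  h+h≡N : h ℕ.+ h ≡ N
  h+h≡N = double-suc q
    where
    double-suc : ∀ q → suc q ℕ.+ suc q ≡ 2 ℕ.+ 2 ℕ.* q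
    double-suc = solve-∀

  ω^ ζ^ : ℕ → Carrier
  ω^ x = ω ^ᴿ x
  ζ^ x = ζ ^ᴿ x

  module ω-root = Primitive (suc (2 ℕ.* q)) ω ω-primitive
  module ζ-root = Primitive (suc (suc (2 ℕ.* q))) ζ ζ-primitive

  ω^-homo : ∀ a b → ω^ (a ℕ.+ b) ≈ ω^ a * ω^ b
  ω^-homo = ^ᴿ-homo-+ ω

  ζ^-homo : ∀ a b → ζ^ (a ℕ.+ b) ≈ ζ^ a * ζ^ b
  ζ^-homo = ^ᴿ-homo-+ ζ

  ω^-cong : ∀ {a b} → a ℤₙ.≋ b → ω^ a ≈ ω^ b
  ω^-cong = ω-root.z^-cong

  ζ^-cong : ∀ {a b} → a ≋ b → ζ^ a ≈ ζ^ b
  ζ^-cong = ζ-root.z^-cong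

  hh≋0 : ∀ m → (h ℕ.+ h) ℕ.* m ℤₙ.≋ 0
  hh≋0 m = ℤₙ.≋-trans (ℤₙ.≡⇒≋ (≡.cong (ℕ._* m) h+h≡N)) (ℤₙ.≋-trans (ℤₙ.≡⇒≋ (ℕₚ.*-comm N m)) (ℤₙ.multiple≋0 m))

  +hh≋ : ∀ x m → x ℕ.+ (h ℕ.+ h) ℕ.* m ℤₙ.≋ x
  +hh≋ x m = ℤₙ.≋-trans (ℤₙ.+≋ˡ x (hh≋0 m)) (ℤₙ.≡⇒≋ (ℕₚ.+-identityʳ x))

  ω^h≈-1 : ω^ h ≈ - 1#
  ω^h≈-1 = x²≈1⇒x≈-1 (trans (sym (ω^-homo h h)) (trans (^ᴿ-congʳ ω h+h≡N) (proj₁ ω-primitive)))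
                      (proj₂ ω-primitive h (s≤s z≤n) (s≤s (s≤s (ℕₚ.m≤m+n q (1 ℕ.* q)))))

  ω^h-even : ∀ m → ω^ (h ℕ.* (2 ℕ.* m)) ≈ 1#
  ω^h-even m = ω^-cong (ℤₙ.≋-trans (ℤₙ.≡⇒≋ (h*2m≡ h m)) (hh≋0 m))
    where
    h*2m≡ : ∀ h m → h ℕ.* (2 ℕ.* m) ≡ (h ℕ.+ h) ℕ.* m
    h*2m≡ = solve-∀

  ω^h-odd : ∀ m → ω^ (h ℕ.* suc (2 ℕ.* m)) ≈ - 1#
  ω^h-odd m = trans (ω^-cong (ℤₙ.≋-trans (ℤₙ.≡⇒≋ (h*[2m+1]≡ h m)) (+hh≋ h m))) ω^h≈-1
    where
    h*[2m+1]≡ : ∀ h m → h ℕ.* suc (2 ℕ.* m) ≡ h ℕ.+ (h ℕ.+ h) ℕ.* m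
    h*[2m+1]≡ = solve-∀

  γ : ℕ → ℕ
  γ k = g ℕ.^ k % p

  γ≋ : ∀ k → γ k ≋ g ℕ.^ k
  γ≋ k = 𝔽ₚ.%≋ (g ℕ.^ k)

  γ-unit : ∀ k → Unit (γ k)
  γ-unit k = 𝔽ₚ.unit-resp-≋ (≋-sym (γ≋ k)) (g^-unit k)

  Σ<-split-zero : ∀ (H : ℕ → Carrier) → Σ< p H ≈ H 0 + Σ< p (λ x → if not (x ≡ᵇ 0) then H x else 0#)
  Σ<-split-zero H = begin
    Σ< p H                                      ≈⟨ Σ<-cong p split ⟩
    Σ< p (λ x → (if x ≡ᵇ 0 then H x else 0#) + (if not (x ≡ᵇ 0) then H x else 0#))
                                                ≈⟨ Σ<-distrib-+ p _ _ ⟩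
    Σ< p (λ x → if x ≡ᵇ 0 then H x else 0#) + Σ< p (λ x → if not (x ≡ᵇ 0) then H x else 0#)
                                                ≈⟨ +-congʳ (Σ<-select p (_≡ᵇ 0) H 0 (s≤s z≤n) ≡.refl (λ x _ → ≡ᵇ⇒≡)) ⟩
    H 0 + Σ< p (λ x → if not (x ≡ᵇ 0) then H x else 0#) ∎
    where
    split : ∀ x → H x ≈ (if x ≡ᵇ 0 then H x else 0#) + (if not (x ≡ᵇ 0) then H x else 0#)
    split x with x ≡ᵇ 0
    ... | true = sym (+-identityʳ _)
    ... | false = sym (+-identityˡ _)

  Σ<-units : ∀ (H : ℕ → Carrier) → Σ< N (λ k → H (γ k)) + H 0 ≈ Σ< p H
  Σ<-units H = begin
    Σ< N (λ k → H (γ k)) + H 0   ≈⟨ +-comm _ _ ⟩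
    H 0 + Σ< N (λ k → H (γ k))   ≈⟨ +-congˡ (Σ<-reindex N p (λ _ → true) (λ x → not (x ≡ᵇ 0)) γ log H forward backward) ⟩
    H 0 + Σ< p (λ x → if not (x ≡ᵇ 0) then H x else 0#) ≈⟨ Σ<-split-zero H ⟨
    Σ< p H                       ∎
    where
    unit⇒nonzero : ∀ {x} → Unit x → not (x % p ≡ᵇ 0) ≡ true
    unit⇒nonzero {x} ux with x % p ≡ᵇ 0 in e
    ... | true = ⊥-elim (ux (mk≋ (≡ᵇ⇒≡ e)))
    ... | false = ≡.refl
    nonzero⇒unit : ∀ {y} → y < p → not (y ≡ᵇ 0) ≡ true → Unit y
    nonzero⇒unit {y} y<p y≢0 (mk≋ y%p≡0) with y ≡ᵇ 0 in e | ≡.trans (≡.sym (m<n⇒m%n≡m y<p)) y%p≡0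
    ... | false | ≡.refl with e
    ...   | ()
    forward : ∀ k → k < N → true ≡ true → γ k < p × not (γ k ≡ᵇ 0) ≡ true × log (γ k) ≡ k
    forward k k<N _ = m%n<n (g ℕ.^ k) p , unit⇒nonzero (g^-unit k) , log-unique k k<N (≋-sym (γ≋ k))
    backward : ∀ y → y < p → not (y ≡ᵇ 0) ≡ true → log y < N × true ≡ true × γ (log y) ≡ y
    backward y y<p y≢0 = let (lt , e) = log-spec y (nonzero⇒unit y<p y≢0)
                         in lt , ≡.refl , ≡.trans (un≋ e) (m<n⇒m%n≡m y<p)

  ζ-units : ∀ c → Σ< N (λ k → ζ^ (γ k ℕ.* c)) + 1# ≈ (if c % p ≡ᵇ 0 then fromℕ p else 0#)
  ζ-units c = trans (Σ<-units (λ x → ζ^ (x ℕ.* c))) (ζ-root.orthogonality c)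

  χ-log : ∀ j x → Unit x → chr j x ≈ ω^ (j ℕ.* log x)
  χ-log j x ux = Σ<-select N (λ k → γ k ≡ᵇ x % p) (λ k → ω^ (j ℕ.* k)) (log x) (proj₁ (log-spec x ux))
                   (≡⇒≡ᵇ (un≋ (g^log ux))) (λ k k<N e → ≡.sym (log-unique {x} k k<N (mk≋ (≡ᵇ⇒≡ {γ k} e))))

  χ-exp : ∀ j x e → x ≋ g ℕ.^ e → chr j x ≈ ω^ (j ℕ.* e)
  χ-exp j x e x≋gᵉ = trans (χ-log j x (𝔽ₚ.unit-resp-≋ (≋-sym x≋gᵉ) (g^-unit e)))
                           (ω^-cong (ℤₙ.*≋ˡ j (log-≋ e (≋-sym x≋gᵉ))))

  gauss-as-log-sum : ∀ j → gauss j ≈ Σ< N (λ k → ω^ (j ℕ.* k) * ζ^ (γ k))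
  gauss-as-log-sum j = begin
    Σ< p (λ x → chr j x * ζ^ x)
      ≈⟨ Σ<-cong p (λ x → trans (*-distribʳ-Σ< N (ζ^ x) _) (Σ<-cong N (λ k → if-*ʳ _ _ _))) ⟩
    Σ< p (λ x → Σ< N (λ k → if γ k ≡ᵇ x % p then ω^ (j ℕ.* k) * ζ^ x else 0#))
      ≈⟨ Σ<-comm p N _ ⟩
    Σ< N (λ k → Σ< p (λ x → if γ k ≡ᵇ x % p then ω^ (j ℕ.* k) * ζ^ x else 0#))
      ≈⟨ Σ<-cong N (λ k → Σ<-select p (λ x → γ k ≡ᵇ x % p) (λ x → ω^ (j ℕ.* k) * ζ^ x) (γ k) (m%n<n (g ℕ.^ k) p)
                            (≡⇒≡ᵇ (≡.sym (m%n%n≡m%n (g ℕ.^ k) p)))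
                            (λ x x<p e → ≡.trans (≡.sym (m<n⇒m%n≡m x<p)) (≡.sym (≡ᵇ⇒≡ e)))) ⟩
    Σ< N (λ k → ω^ (j ℕ.* k) * ζ^ (γ k)) ∎

  G : Carrier
  G = Σ< N (λ k → ω^ (h ℕ.* k) * ζ^ (γ k))

  φi≡h : φi ≡ h
  φi≡h = ≡.trans (≡.cong (ℕ._/ 2) (N≡h*2 q)) (m*n/n≡m h 2)
    where
    N≡h*2 : ∀ q → 2 ℕ.+ 2 ℕ.* q ≡ suc q ℕ.* 2
    N≡h*2 = solve-∀

  gauss-φ : gauss φi ≈ G
  gauss-φ = trans (reflexive (≡.cong gauss φi≡h)) (gauss-as-log-sum h)

  Σ<-shift : ∀ δ (f : ℕ → Carrier) → Σ< N (λ i → f ((i ℕ.+ δ) % N)) ≈ Σ< N f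
  Σ<-shift δ f = trans (Σ<-cong N (λ i → reflexive (≡.cong (λ z → f ((z ℕ.+ δ) % N)) (≡.sym (ℕₚ.*-identityˡ i)))))
                       (AffineSubstitution.Σ<-affine R (suc (2 ℕ.* q)) 1 1 δ ℤₙ.≋-refl f)

  φ-twisted-sum : ∀ d δ → d ≋ g ℕ.^ δ → Σ< N (λ k → ω^ (h ℕ.* k) * ζ^ (γ k ℕ.* d)) ≈ ω^ (h ℕ.* δ) * G
  φ-twisted-sum d δ d≋gᵟ = begin
    Σ< N (λ k → ω^ (h ℕ.* k) * ζ^ (γ k ℕ.* d))  ≈⟨ Σ<-cong N shifted ⟩
    Σ< N (λ k → f ((k ℕ.+ δ) % N))              ≈⟨ Σ<-shift δ f ⟩
    Σ< N f                                      ≈⟨ Σ<-cong N factor ⟩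
    Σ< N (λ k → ω^ (h ℕ.* δ) * (ω^ (h ℕ.* k) * ζ^ (γ k)))  ≈⟨ *-distribˡ-Σ< N _ _ ⟨
    ω^ (h ℕ.* δ) * G                            ∎
    where
    f : ℕ → Carrier
    f m = ω^ (h ℕ.* m ℕ.+ h ℕ.* δ) * ζ^ (γ m)
    factor : ∀ k → f k ≈ ω^ (h ℕ.* δ) * (ω^ (h ℕ.* k) * ζ^ (γ k))
    factor k = trans (*-congʳ (trans (^ᴿ-congʳ ω (ℕₚ.+-comm (h ℕ.* k) (h ℕ.* δ))) (ω^-homo (h ℕ.* δ) (h ℕ.* k))))
                     (*-assoc _ _ _)
    shifted : ∀ k → ω^ (h ℕ.* k) * ζ^ (γ k ℕ.* d) ≈ f ((k ℕ.+ δ) % N)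
    shifted k = *-cong (ω^-cong exponent) (ζ^-cong argument)
      where
      regroup : ∀ h k δ → h ℕ.* (k ℕ.+ δ) ℕ.+ h ℕ.* δ ≡ h ℕ.* k ℕ.+ (h ℕ.+ h) ℕ.* δ
      regroup = solve-∀
      exponent : h ℕ.* k ℤₙ.≋ h ℕ.* ((k ℕ.+ δ) % N) ℕ.+ h ℕ.* δ
      exponent = ℤₙ-Reasoning.begin
        h ℕ.* k                              ℤₙ-Reasoning.≈⟨ +hh≋ (h ℕ.* k) δ ⟨
        h ℕ.* k ℕ.+ (h ℕ.+ h) ℕ.* δ          ℤₙ-Reasoning.≡⟨ regroup h k δ ⟨
        h ℕ.* (k ℕ.+ δ) ℕ.+ h ℕ.* δ          ℤₙ-Reasoning.≈⟨ ℤₙ.+≋ʳ (h ℕ.* δ) (ℤₙ.*≋ˡ h (ℤₙ.≋-sym (ℤₙ.%≋ (k ℕ.+ δ)))) ⟩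
        h ℕ.* ((k ℕ.+ δ) % N) ℕ.+ h ℕ.* δ    ℤₙ-Reasoning.∎
      argument : γ k ℕ.* d ≋ γ ((k ℕ.+ δ) % N)
      argument = 𝔽-Reasoning.begin
        γ k ℕ.* d                  𝔽-Reasoning.≈⟨ 𝔽ₚ.*≋ (γ≋ k) d≋gᵟ ⟩
        g ℕ.^ k ℕ.* g ℕ.^ δ        𝔽-Reasoning.≡⟨ ℕₚ.^-distribˡ-+-* g k δ ⟨
        g ℕ.^ (k ℕ.+ δ)            𝔽-Reasoning.≈⟨ g^-cong (ℤₙ.≋-sym (ℤₙ.%≋ (k ℕ.+ δ))) ⟩
        g ℕ.^ ((k ℕ.+ δ) % N)      𝔽-Reasoning.≈⟨ γ≋ ((k ℕ.+ δ) % N) ⟨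
        γ ((k ℕ.+ δ) % N)          𝔽-Reasoning.∎

  γ²≋ : ∀ m → γ m ℕ.* γ m ≋ g ℕ.^ (m ℕ.+ m)
  γ²≋ m = ≋-trans (𝔽ₚ.*≋ (γ≋ m) (γ≋ m)) (≡⇒≋ (≡.sym (ℕₚ.^-distribˡ-+-* g m m)))

  -- Each nonzero square x² = g^(2m) is hit by exactly the two exponents m and m + h,
  -- and 1 + φ(g^k) is 2 or 0 according to the parity of k.
  Σ<-squares : ∀ d → Σ< N (λ k → ζ^ (γ k ℕ.* γ k ℕ.* d))
                   ≈ Σ< N (λ k → ζ^ (γ k ℕ.* d)) + Σ< N (λ k → ω^ (h ℕ.* k) * ζ^ (γ k ℕ.* d))
  Σ<-squares d = begin
    Σ< N F²                                   ≈⟨ Σ<-length F² (≡.sym h+h≡N) ⟩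
    Σ< (h ℕ.+ h) F²                           ≈⟨ Σ<-split h h F² ⟩
    Σ< h F² + Σ< h (λ i → F² (h ℕ.+ i))       ≈⟨ +-congˡ (Σ<-cong h periodic) ⟩
    Σ< h F² + Σ< h F²                         ≈⟨ Σ<-distrib-+ h F² F² ⟨
    Σ< h (λ m → F² m + F² m)                  ≈⟨ Σ<-cong h pair ⟨
    Σ< h (λ m → T (2 ℕ.* m) + T (suc (2 ℕ.* m)))  ≈⟨ Σ<-even-odd h T ⟨
    Σ< (h ℕ.+ h) T                            ≈⟨ Σ<-length T h+h≡N ⟩
    Σ< N T                                    ≈⟨ Σ<-distrib-+ N F (λ k → ω^ (h ℕ.* k) * F k) ⟩
    Σ< N F + Σ< N (λ k → ω^ (h ℕ.* k) * F k)  ∎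
    where
    F F² T : ℕ → Carrier
    F k = ζ^ (γ k ℕ.* d)
    F² k = ζ^ (γ k ℕ.* γ k ℕ.* d)
    T k = F k + ω^ (h ℕ.* k) * F k
    periodic : ∀ i → F² (h ℕ.+ i) ≈ F² i
    periodic i = ζ^-cong (𝔽ₚ.*≋ʳ d (𝔽-Reasoning.begin
      γ (h ℕ.+ i) ℕ.* γ (h ℕ.+ i)     𝔽-Reasoning.≈⟨ γ²≋ (h ℕ.+ i) ⟩
      g ℕ.^ (h ℕ.+ i ℕ.+ (h ℕ.+ i))   𝔽-Reasoning.≡⟨ ≡.cong (g ℕ.^_) (≡.trans (regroup h i) (≡.cong (λ z → i ℕ.+ i ℕ.+ z ℕ.* 1) h+h≡N)) ⟩
      g ℕ.^ (i ℕ.+ i ℕ.+ N ℕ.* 1)     𝔽-Reasoning.≈⟨ g^-cong (ℤₙ.≋-trans (ℤₙ.+≋ˡ (i ℕ.+ i) (ℤₙ.≡⇒≋ (ℕₚ.*-comm N 1))) (ℤₙ.+multiple≋ (i ℕ.+ i) 1)) ⟩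
      g ℕ.^ (i ℕ.+ i)                 𝔽-Reasoning.≈⟨ γ²≋ i ⟨
      γ i ℕ.* γ i                     𝔽-Reasoning.∎))
      where
      regroup : ∀ h i → h ℕ.+ i ℕ.+ (h ℕ.+ i) ≡ i ℕ.+ i ℕ.+ (h ℕ.+ h) ℕ.* 1
      regroup = solve-∀
    F-even : ∀ m → F (2 ℕ.* m) ≈ F² m
    F-even m = ζ^-cong (𝔽ₚ.*≋ʳ d (≋-trans (γ≋ (2 ℕ.* m)) (≋-trans (≡⇒≋ (≡.cong (g ℕ.^_) (2m≡m+m m))) (≋-sym (γ²≋ m)))))
      where
      2m≡m+m : ∀ m → 2 ℕ.* m ≡ m ℕ.+ m
      2m≡m+m = solve-∀
    pair : ∀ m → T (2 ℕ.* m) + T (suc (2 ℕ.* m)) ≈ F² m + F² m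
    pair m = begin
      T (2 ℕ.* m) + T (suc (2 ℕ.* m))
        ≈⟨ +-cong (+-congˡ (trans (*-congʳ (ω^h-even m)) (*-identityˡ _)))
                  (trans (+-congˡ (trans (*-congʳ (ω^h-odd m)) (-1*x≈-x _))) (-‿inverseʳ _)) ⟩
      (F (2 ℕ.* m) + F (2 ℕ.* m)) + 0#   ≈⟨ +-identityʳ _ ⟩
      F (2 ℕ.* m) + F (2 ℕ.* m)          ≈⟨ +-cong (F-even m) (F-even m) ⟩
      F² m + F² m                        ∎

  quadratic-gauss-sum : ∀ d δ → d ≋ g ℕ.^ δ → Σ< p (λ x → ζ^ (x ℕ.* x ℕ.* d)) ≈ ω^ (h ℕ.* δ) * G
  quadratic-gauss-sum d δ d≋gᵟ = begin
    Σ< p (λ x → ζ^ (x ℕ.* x ℕ.* d))                ≈⟨ Σ<-units (λ x → ζ^ (x ℕ.* x ℕ.* d)) ⟨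
    Σ< N (λ k → ζ^ (γ k ℕ.* γ k ℕ.* d)) + 1#       ≈⟨ +-congʳ (Σ<-squares d) ⟩
    (Σ< N (λ k → ζ^ (γ k ℕ.* d)) + Σ< N (λ k → ω^ (h ℕ.* k) * ζ^ (γ k ℕ.* d))) + 1#
                                                   ≈⟨ xy∙z≈xz∙y _ _ _ ⟩
    (Σ< N (λ k → ζ^ (γ k ℕ.* d)) + 1#) + Σ< N (λ k → ω^ (h ℕ.* k) * ζ^ (γ k ℕ.* d))
                                                   ≈⟨ +-cong (trans (ζ-units d) (reflexive (≡.cong (λ b → if b then fromℕ p else 0#) d≢0)))
                                                             (φ-twisted-sum d δ d≋gᵟ) ⟩
    0# + ω^ (h ℕ.* δ) * G                          ≈⟨ +-identityˡ _ ⟩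
    ω^ (h ℕ.* δ) * G                               ∎
    where
    d≢0 : (d % p ≡ᵇ 0) ≡ false
    d≢0 = ≢⇒≡ᵇ-false (λ e → g^-unit δ (≋-trans (≋-sym d≋gᵟ) (mk≋ e)))

  2-unit : Unit 2
  2-unit (mk≋ ())

  -- c v² + v = c (v + 1/(2c))² - 1/(4c)
  complete-square : ∀ c v → Unit c →
    v ℕ.* v ℕ.* c ℕ.+ v ≋ (2 ℕ.* c ℕ.* v ℕ.+ 1) ℕ.* (2 ℕ.* c ℕ.* v ℕ.+ 1) ℕ.* recip (4 ℕ.* c) ℕ.+ negate (recip (4 ℕ.* c))
  complete-square c v uc = 𝔽-Reasoning.begin
    v ℕ.* v ℕ.* c ℕ.+ v                                  𝔽-Reasoning.≡⟨ ℕₚ.*-identityʳ _ ⟨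
    (v ℕ.* v ℕ.* c ℕ.+ v) ℕ.* 1                          𝔽-Reasoning.≈⟨ 𝔽ₚ.*≋ˡ (v ℕ.* v ℕ.* c ℕ.+ v) (*-recip 4c-unit) ⟨
    (v ℕ.* v ℕ.* c ℕ.+ v) ℕ.* (4 ℕ.* c ℕ.* D)            𝔽-Reasoning.≈⟨ 𝔽ₚ.+multiple≋ _ D ⟨
    (v ℕ.* v ℕ.* c ℕ.+ v) ℕ.* (4 ℕ.* c ℕ.* D) ℕ.+ D ℕ.* p 𝔽-Reasoning.≡⟨ regroup q c v D ⟨
    (2 ℕ.* c ℕ.* v ℕ.+ 1) ℕ.* (2 ℕ.* c ℕ.* v ℕ.+ 1) ℕ.* D ℕ.+ negate D 𝔽-Reasoning.∎
    where
    D : ℕ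
    D = recip (4 ℕ.* c)
    4c-unit : Unit (4 ℕ.* c)
    4c-unit = 𝔽ₚ.unit-* (𝔽ₚ.unit-* 2-unit 2-unit) uc
    regroup : ∀ q c v D → (2 ℕ.* c ℕ.* v ℕ.+ 1) ℕ.* (2 ℕ.* c ℕ.* v ℕ.+ 1) ℕ.* D ℕ.+ (2 ℕ.+ 2 ℕ.* q) ℕ.* D
                        ≡ (v ℕ.* v ℕ.* c ℕ.+ v) ℕ.* (4 ℕ.* c ℕ.* D) ℕ.+ D ℕ.* (3 ℕ.+ 2 ℕ.* q)
    regroup = solve-∀

  Σ<-complete-square : ∀ c → Unit c →
    Σ< p (λ v → ζ^ (v ℕ.* v ℕ.* c ℕ.+ v))
      ≈ Σ< p (λ y → ζ^ (y ℕ.* y ℕ.* recip (4 ℕ.* c))) * ζ^ (negate (recip (4 ℕ.* c)))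
  Σ<-complete-square c uc = begin
    Σ< p (λ v → ζ^ (v ℕ.* v ℕ.* c ℕ.+ v))           ≈⟨ Σ<-cong p pointwise ⟩
    Σ< p (λ v → F (σ v) * ζ^ (negate D))            ≈⟨ *-distribʳ-Σ< p _ _ ⟨
    Σ< p (λ v → F (σ v)) * ζ^ (negate D)            ≈⟨ *-congʳ (AffineSubstitution.Σ<-affine R (suc (suc (2 ℕ.* q)))
                                                         (2 ℕ.* c) (recip (2 ℕ.* c)) 1 (*-recip (𝔽ₚ.unit-* 2-unit uc)) F) ⟩
    Σ< p F * ζ^ (negate D)                          ∎
    where
    D : ℕ
    D = recip (4 ℕ.* c)
    F : ℕ → Carrier
    F y = ζ^ (y ℕ.* y ℕ.* D)
    σ : ℕ → ℕ
    σ v = (2 ℕ.* c ℕ.* v ℕ.+ 1) % p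
    pointwise : ∀ v → ζ^ (v ℕ.* v ℕ.* c ℕ.+ v) ≈ F (σ v) * ζ^ (negate D)
    pointwise v = trans (ζ^-cong (≋-trans (complete-square c v uc) (𝔽ₚ.+≋ʳ (negate D) (𝔽ₚ.*≋ʳ D (𝔽ₚ.*≋ σv σv)))))
                        (ζ^-homo (σ v ℕ.* σ v ℕ.* D) (negate D))
      where
      σv : 2 ℕ.* c ℕ.* v ℕ.+ 1 ≋ σ v
      σv = ≋-sym (𝔽ₚ.%≋ (2 ℕ.* c ℕ.* v ℕ.+ 1))

  log₂ : ℕ
  log₂ = log 2

  g^log₂ : g ℕ.^ log₂ ≋ 2
  g^log₂ = g^log 2-unit

  -- ζ^(-1/(4 g^l)), the constant left over by completing the square.
  ζ-shift : ℕ → Carrier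
  ζ-shift l = ζ^ (negate (recip (4 ℕ.* g ℕ.^ l)))

  Σ<-quadratic-exponent : ∀ l → Σ< N (λ k → ζ^ (g ℕ.^ (l ℕ.+ (k ℕ.+ k)) ℕ.+ γ k)) ≈ ω^ (h ℕ.* l) * G * ζ-shift l - 1#
  Σ<-quadratic-exponent l = x+1≈y⇒x≈y-1 (begin
    Σ< N (λ k → ζ^ (g ℕ.^ (l ℕ.+ (k ℕ.+ k)) ℕ.+ γ k)) + 1#   ≈⟨ +-congʳ (Σ<-cong N (λ k → ζ^-cong (𝔽ₚ.+≋ʳ (γ k) (exponent k)))) ⟩
    Σ< N (λ k → H (γ k)) + H 0                             ≈⟨ Σ<-units H ⟩
    Σ< p H                                                 ≈⟨ Σ<-complete-square c (g^-unit l) ⟩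
    Σ< p (λ y → ζ^ (y ℕ.* y ℕ.* D)) * ζ-shift l            ≈⟨ *-congʳ (quadratic-gauss-sum D δ D≋gᵟ) ⟩
    ω^ (h ℕ.* δ) * G * ζ-shift l                           ≈⟨ *-congʳ (*-congʳ (ω^-cong hδ≋hl)) ⟩
    ω^ (h ℕ.* l) * G * ζ-shift l                           ∎)
    where
    c D δ : ℕ
    c = g ℕ.^ l
    D = recip (4 ℕ.* c)
    δ = (log₂ ℕ.+ log₂ ℕ.+ l) ℕ.* (1 ℕ.+ 2 ℕ.* q)
    H : ℕ → Carrier
    H v = ζ^ (v ℕ.* v ℕ.* c ℕ.+ v)
    exponent : ∀ k → g ℕ.^ (l ℕ.+ (k ℕ.+ k)) ≋ γ k ℕ.* γ k ℕ.* c
    exponent k = 𝔽-Reasoning.begin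
      g ℕ.^ (l ℕ.+ (k ℕ.+ k))    𝔽-Reasoning.≡⟨ ℕₚ.^-distribˡ-+-* g l (k ℕ.+ k) ⟩
      c ℕ.* g ℕ.^ (k ℕ.+ k)      𝔽-Reasoning.≈⟨ 𝔽ₚ.*≋ˡ c (γ²≋ k) ⟨
      c ℕ.* (γ k ℕ.* γ k)        𝔽-Reasoning.≡⟨ ℕₚ.*-comm c (γ k ℕ.* γ k) ⟩
      γ k ℕ.* γ k ℕ.* c          𝔽-Reasoning.∎
    D≋gᵟ : D ≋ g ℕ.^ δ
    D≋gᵟ = 𝔽-Reasoning.begin
      recip (4 ℕ.* c)                              𝔽-Reasoning.≈⟨ 𝔽ₚ.^≋ (1 ℕ.+ 2 ℕ.* q) 4c≋ ⟩
      (g ℕ.^ (log₂ ℕ.+ log₂ ℕ.+ l)) ℕ.^ (1 ℕ.+ 2 ℕ.* q) 𝔽-Reasoning.≡⟨ ℕₚ.^-*-assoc g (log₂ ℕ.+ log₂ ℕ.+ l) (1 ℕ.+ 2 ℕ.* q) ⟩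
      g ℕ.^ δ                                      𝔽-Reasoning.∎
      where
      4c≋ : 4 ℕ.* c ≋ g ℕ.^ (log₂ ℕ.+ log₂ ℕ.+ l)
      4c≋ = 𝔽-Reasoning.begin
        4 ℕ.* c                            𝔽-Reasoning.≈⟨ 𝔽ₚ.*≋ʳ c (𝔽ₚ.*≋ g^log₂ g^log₂) ⟨
        g ℕ.^ log₂ ℕ.* g ℕ.^ log₂ ℕ.* c    𝔽-Reasoning.≡⟨ ≡.cong (ℕ._* c) (ℕₚ.^-distribˡ-+-* g log₂ log₂) ⟨
        g ℕ.^ (log₂ ℕ.+ log₂) ℕ.* c        𝔽-Reasoning.≡⟨ ℕₚ.^-distribˡ-+-* g (log₂ ℕ.+ log₂) l ⟨
        g ℕ.^ (log₂ ℕ.+ log₂ ℕ.+ l)        𝔽-Reasoning.∎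
    hδ≋hl : h ℕ.* δ ℤₙ.≋ h ℕ.* l
    hδ≋hl = ℤₙ.≋-trans (ℤₙ.≡⇒≋ (regroup q log₂ l)) (ℤₙ.+multiple≋ (h ℕ.* l) (log₂ ℕ.* (1 ℕ.+ 2 ℕ.* q) ℕ.+ q ℕ.* l))
      where
      regroup : ∀ q a l → suc q ℕ.* ((a ℕ.+ a ℕ.+ l) ℕ.* (1 ℕ.+ 2 ℕ.* q))
                        ≡ suc q ℕ.* l ℕ.+ (a ℕ.* (1 ℕ.+ 2 ℕ.* q) ℕ.+ q ℕ.* l) ℕ.* (2 ℕ.+ 2 ℕ.* q)
      regroup = solve-∀

  module Proposition53 (n₁ t : ℕ) (nn₁-unit : unitMod p (suc n₁ ℕ.* n₁)) (1≤t : 1 ≤ t) (t<p : t < p) where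
    open Prop53 (suc n₁) t
    open CommutativeMonoidSolver *-commutativeMonoid using (solve; _⊜_) renaming (_⊕_ to _⊛_)

    n : ℕ
    n = suc n₁

    t-unit : Unit t
    t-unit (mk≋ t%p≡0) = ℕₚ.<⇒≢ 1≤t (≡.sym (≡.trans (≡.sym (m<n⇒m%n≡m t<p)) t%p≡0))

    n-unit : Unit n
    n-unit n≋0 = nn₁-unit (un≋ (𝔽ₚ.*≋ʳ n₁ n≋0))

    n₁-unit : Unit n₁
    n₁-unit n₁≋0 = nn₁-unit (un≋ (≋-trans (𝔽ₚ.*≋ˡ n n₁≋0) (≡⇒≋ (ℕₚ.*-zeroʳ n))))

    minus-one-unit : Unit minus-one
    minus-one-unit (mk≋ e) with ≡.trans (≡.sym (m<n⇒m%n≡m {m = minus-one} ℕₚ.≤-refl)) e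
    ... | ()

    1-n≋-n₁ : oneMinusN ≋ negate n₁
    1-n≋-n₁ = 𝔽ₚ.+-cancelʳ-≋ n₁ (𝔽-Reasoning.begin
      oneMinusN ℕ.+ n₁                  𝔽-Reasoning.≈⟨ 𝔽ₚ.+≋ʳ n₁ (𝔽ₚ.%≋ _) ⟩
      (p ℕ.* n ℕ.+ 1 ℕ.∸ n) ℕ.+ n₁      𝔽-Reasoning.≡⟨ ≡.cong (λ z → z ℕ.∸ n ℕ.+ n₁) (ℕₚ.+-comm (p ℕ.* n) 1) ⟩
      (suc (p ℕ.* n) ℕ.∸ n) ℕ.+ n₁      𝔽-Reasoning.≡⟨ ℕₚ.m∸n+n≡m (ℕₚ.≤-trans (ℕₚ.n≤1+n n₁) (ℕₚ.m≤n*m n p)) ⟩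
      p ℕ.* n                           𝔽-Reasoning.≈⟨ ≋-trans (≡⇒≋ (ℕₚ.*-comm p n)) (𝔽ₚ.multiple≋0 n) ⟩
      0                                 𝔽-Reasoning.≈⟨ negate-+ n₁ ⟨
      negate n₁ ℕ.+ n₁                  𝔽-Reasoning.∎)

    1-n-unit : Unit oneMinusN
    1-n-unit = 𝔽ₚ.unit-resp-≋ (≋-sym 1-n≋-n₁) (𝔽ₚ.unit-* minus-one-unit n₁-unit)

    nninv-unit : Unit nninv
    nninv-unit = 𝔽ₚ.unit-resp-≋ (≋-sym (𝔽ₚ.%≋ _)) (𝔽ₚ.unit-^ (1 ℕ.+ 2 ℕ.* q) (𝔽ₚ.unit-^ n n-unit))

    αt-unit : Unit (α ℕ.* t)
    αt-unit = 𝔽ₚ.unit-* (𝔽ₚ.unit-resp-≋ (≋-sym (𝔽ₚ.%≋ _))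
                          (𝔽ₚ.unit-* (𝔽ₚ.unit-* (𝔽ₚ.unit-* 2-unit 2-unit) (𝔽ₚ.unit-^ n₁ 1-n-unit)) nninv-unit)) t-unit

    log-αt : ℕ
    log-αt = log (α ℕ.* t)

    -- Writing χ = χ_j, the four Gauss sums and χ̄(αt) contribute ω^(h k₁ + j E) where
    -- E is the exponent below (p - 2 plays the role of -1 modulo p - 1).
    linear-part : ℕ → ℕ → ℕ → ℕ
    linear-part k₁ k₂ k₄ = n₁ ℕ.* k₁ ℕ.+ (1 ℕ.+ 2 ℕ.* q) ℕ.* n ℕ.* k₂ ℕ.+ 2 ℕ.* k₄ ℕ.+ (1 ℕ.+ 2 ℕ.* q) ℕ.* log-αt

    exponent : ℕ → ℕ → ℕ → ℕ → ℕ
    exponent k₁ k₂ k₃ k₄ = linear-part k₁ k₂ k₄ ℕ.+ (1 ℕ.+ 2 ℕ.* q) ℕ.* k₃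

    X : ℕ → ℕ → ℕ → ℕ → Carrier
    X k₁ k₂ k₃ k₄ = ω^ (h ℕ.* k₁) * (ζ^ (γ k₁) * ζ^ (γ k₂) * ζ^ (γ k₃) * ζ^ (γ k₄))

    Σ⁴ : (ℕ → ℕ → ℕ → ℕ → Carrier) → Carrier
    Σ⁴ f = Σ< N (λ k₁ → Σ< N (λ k₂ → Σ< N (λ k₃ → Σ< N (λ k₄ → f k₁ k₂ k₃ k₄))))

    Σ⁴-cong : ∀ {f f′} → (∀ k₁ k₂ k₃ k₄ → f k₁ k₂ k₃ k₄ ≈ f′ k₁ k₂ k₃ k₄) → Σ⁴ f ≈ Σ⁴ f′
    Σ⁴-cong f≈f′ = Σ<-cong N (λ k₁ → Σ<-cong N (λ k₂ → Σ<-cong N (λ k₃ → Σ<-cong N (f≈f′ k₁ k₂ k₃))))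

    Σ⁴-product : ∀ (a b c d : ℕ → Carrier) w →
      Σ< N a * Σ< N b * Σ< N c * Σ< N d * w ≈ Σ⁴ (λ k₁ k₂ k₃ k₄ → a k₁ * b k₂ * c k₃ * d k₄ * w)
    Σ⁴-product a b c d w = begin
      Σ< N a * Σ< N b * Σ< N c * Σ< N d * w
        ≈⟨ right-nest _ _ _ _ _ ⟩
      Σ< N a * (Σ< N b * (Σ< N c * (Σ< N d * w)))
        ≈⟨ *-distribʳ-Σ< N _ a ⟩
      Σ< N (λ k₁ → a k₁ * (Σ< N b * (Σ< N c * (Σ< N d * w))))
        ≈⟨ Σ<-cong N (λ k₁ → pull-in (a k₁) b) ⟩
      Σ< N (λ k₁ → Σ< N (λ k₂ → a k₁ * (b k₂ * (Σ< N c * (Σ< N d * w)))))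
        ≈⟨ Σ<-cong N (λ k₁ → Σ<-cong N (λ k₂ → trans (*-congˡ (pull-in (b k₂) c)) (*-distribˡ-Σ< N _ _))) ⟩
      Σ< N (λ k₁ → Σ< N (λ k₂ → Σ< N (λ k₃ → a k₁ * (b k₂ * (c k₃ * (Σ< N d * w))))))
        ≈⟨ Σ⁴-cong′ (λ k₁ k₂ k₃ → trans (*-congˡ (trans (*-congˡ (pull-in (c k₃) d)) (*-distribˡ-Σ< N _ _)))
                                         (*-distribˡ-Σ< N _ _)) ⟩
      Σ⁴ (λ k₁ k₂ k₃ k₄ → a k₁ * (b k₂ * (c k₃ * (d k₄ * w))))
        ≈⟨ Σ⁴-cong (λ _ _ _ _ → sym (right-nest _ _ _ _ _)) ⟩
      Σ⁴ (λ k₁ k₂ k₃ k₄ → a k₁ * b k₂ * c k₃ * d k₄ * w) ∎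
      where
      right-nest : ∀ x y z u v → x * y * z * u * v ≈ x * (y * (z * (u * v)))
      right-nest x y z u v = trans (*-assoc _ _ _) (trans (*-assoc _ _ _) (*-assoc _ _ _))
      pull-in : ∀ x (f : ℕ → Carrier) {y} → x * (Σ< N f * y) ≈ Σ< N (λ k → x * (f k * y))
      pull-in x f {y} = trans (*-congˡ (*-distribʳ-Σ< N y f)) (*-distribˡ-Σ< N x _)
      Σ⁴-cong′ : ∀ {f : ℕ → ℕ → ℕ → Carrier} {f′ : ℕ → ℕ → ℕ → ℕ → Carrier} →
        (∀ k₁ k₂ k₃ → f k₁ k₂ k₃ ≈ Σ< N (f′ k₁ k₂ k₃)) →
        Σ< N (λ k₁ → Σ< N (λ k₂ → Σ< N (f k₁ k₂))) ≈ Σ⁴ f′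
      Σ⁴-cong′ f≈ = Σ<-cong N (λ k₁ → Σ<-cong N (λ k₂ → Σ<-cong N (f≈ k₁ k₂)))

    gauss-summand : ℕ → ℕ → Carrier
    gauss-summand i k = ω^ (i ℕ.* k) * ζ^ (γ k)

    gauss-summands-product : ∀ j k₁ k₂ k₃ k₄ →
      gauss-summand (h ℕ.+ j ℕ.* n₁) k₁ * gauss-summand (inv j ℕ.* n) k₂ * gauss-summand (inv j) k₃
        * gauss-summand (j ℕ.* 2) k₄ * ω^ (inv j ℕ.* log-αt)
        ≈ X k₁ k₂ k₃ k₄ * ω^ (j ℕ.* exponent k₁ k₂ k₃ k₄)
    gauss-summands-product j k₁ k₂ k₃ k₄ = begin
      (ω^ e₁ * z₁) * (ω^ e₂ * z₂) * (ω^ e₃ * z₃) * (ω^ e₄ * z₄) * ω^ e₅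
        ≈⟨ solve 9 (λ a₁ b₁ a₂ b₂ a₃ b₃ a₄ b₄ a₅ →
                      ((((a₁ ⊛ b₁) ⊛ (a₂ ⊛ b₂)) ⊛ (a₃ ⊛ b₃)) ⊛ (a₄ ⊛ b₄)) ⊛ a₅
                      ⊜ (a₁ ⊛ (a₂ ⊛ (a₃ ⊛ (a₄ ⊛ a₅)))) ⊛ (((b₁ ⊛ b₂) ⊛ b₃) ⊛ b₄))
                   refl (ω^ e₁) z₁ (ω^ e₂) z₂ (ω^ e₃) z₃ (ω^ e₄) z₄ (ω^ e₅) ⟩
      (ω^ e₁ * (ω^ e₂ * (ω^ e₃ * (ω^ e₄ * ω^ e₅)))) * Z
        ≈⟨ *-congʳ (sym (trans (ω^-homo e₁ _) (*-congˡ (trans (ω^-homo e₂ _) (*-congˡ (trans (ω^-homo e₃ _)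
                                 (*-congˡ (ω^-homo e₄ e₅)))))))) ⟩
      ω^ (e₁ ℕ.+ (e₂ ℕ.+ (e₃ ℕ.+ (e₄ ℕ.+ e₅)))) * Z
        ≈⟨ *-congʳ (^ᴿ-congʳ ω (regroup q h n₁ j k₁ k₂ k₃ k₄ log-αt)) ⟩
      ω^ (h ℕ.* k₁ ℕ.+ j ℕ.* exponent k₁ k₂ k₃ k₄) * Z
        ≈⟨ *-congʳ (ω^-homo (h ℕ.* k₁) _) ⟩
      ω^ (h ℕ.* k₁) * ω^ (j ℕ.* exponent k₁ k₂ k₃ k₄) * Z
        ≈⟨ solve 3 (λ a b c → (a ⊛ b) ⊛ c ⊜ (a ⊛ c) ⊛ b) refl _ _ Z ⟩
      X k₁ k₂ k₃ k₄ * ω^ (j ℕ.* exponent k₁ k₂ k₃ k₄) ∎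
      where
      e₁ e₂ e₃ e₄ e₅ : ℕ
      e₁ = (h ℕ.+ j ℕ.* n₁) ℕ.* k₁
      e₂ = inv j ℕ.* n ℕ.* k₂
      e₃ = inv j ℕ.* k₃
      e₄ = j ℕ.* 2 ℕ.* k₄
      e₅ = inv j ℕ.* log-αt
      z₁ z₂ z₃ z₄ Z : Carrier
      z₁ = ζ^ (γ k₁)
      z₂ = ζ^ (γ k₂)
      z₃ = ζ^ (γ k₃)
      z₄ = ζ^ (γ k₄)
      Z = z₁ * z₂ * z₃ * z₄
      regroup : ∀ q h n₁ j k₁ k₂ k₃ k₄ l →
        (h ℕ.+ j ℕ.* n₁) ℕ.* k₁ ℕ.+ (((1 ℕ.+ 2 ℕ.* q) ℕ.* j ℕ.* suc n₁) ℕ.* k₂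
          ℕ.+ (((1 ℕ.+ 2 ℕ.* q) ℕ.* j) ℕ.* k₃ ℕ.+ ((j ℕ.* 2) ℕ.* k₄ ℕ.+ ((1 ℕ.+ 2 ℕ.* q) ℕ.* j) ℕ.* l)))
        ≡ h ℕ.* k₁ ℕ.+ j ℕ.* (n₁ ℕ.* k₁ ℕ.+ (1 ℕ.+ 2 ℕ.* q) ℕ.* suc n₁ ℕ.* k₂ ℕ.+ 2 ℕ.* k₄
                               ℕ.+ (1 ℕ.+ 2 ℕ.* q) ℕ.* l ℕ.+ (1 ℕ.+ 2 ℕ.* q) ℕ.* k₃)
      regroup = solve-∀

    term-expansion : ∀ j →
      gauss (φi ℕ.+ j ℕ.* n₁) * gauss (inv j ℕ.* n) * gauss (inv j) * gauss (j ℕ.* 2) * chr (inv j) (α ℕ.* t)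
        ≈ Σ⁴ (λ k₁ k₂ k₃ k₄ → X k₁ k₂ k₃ k₄ * ω^ (j ℕ.* exponent k₁ k₂ k₃ k₄))
    term-expansion j = begin
      gauss (φi ℕ.+ j ℕ.* n₁) * gauss (inv j ℕ.* n) * gauss (inv j) * gauss (j ℕ.* 2) * chr (inv j) (α ℕ.* t)
        ≈⟨ *-cong (*-cong (*-cong (*-cong (trans (reflexive (≡.cong (λ i → gauss (i ℕ.+ j ℕ.* n₁)) φi≡h))
                                                  (gauss-as-log-sum (h ℕ.+ j ℕ.* n₁)))
                                           (gauss-as-log-sum (inv j ℕ.* n)))
                                   (gauss-as-log-sum (inv j)))
                           (gauss-as-log-sum (j ℕ.* 2)))
                   (χ-log (inv j) (α ℕ.* t) αt-unit) ⟩
      Σ< N (gauss-summand (h ℕ.+ j ℕ.* n₁)) * Σ< N (gauss-summand (inv j ℕ.* n)) * Σ< N (gauss-summand (inv j))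
        * Σ< N (gauss-summand (j ℕ.* 2)) * ω^ (inv j ℕ.* log-αt)
        ≈⟨ Σ⁴-product _ _ _ _ _ ⟩
      Σ⁴ (λ k₁ k₂ k₃ k₄ → gauss-summand (h ℕ.+ j ℕ.* n₁) k₁ * gauss-summand (inv j ℕ.* n) k₂ * gauss-summand (inv j) k₃
                            * gauss-summand (j ℕ.* 2) k₄ * ω^ (inv j ℕ.* log-αt))
        ≈⟨ Σ⁴-cong (gauss-summands-product j) ⟩
      Σ⁴ (λ k₁ k₂ k₃ k₄ → X k₁ k₂ k₃ k₄ * ω^ (j ℕ.* exponent k₁ k₂ k₃ k₄)) ∎

    A≈Σ⁴-constrained : A ≈ Σ⁴ (λ k₁ k₂ k₃ k₄ → X k₁ k₂ k₃ k₄ * (if exponent k₁ k₂ k₃ k₄ % N ≡ᵇ 0 then fromℕ N else 0#))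
    A≈Σ⁴-constrained = begin
      A                                                                          ≈⟨ Σ<-cong N term-expansion ⟩
      Σ< N (λ j → Σ⁴ (λ k₁ k₂ k₃ k₄ → X k₁ k₂ k₃ k₄ * ω^ (j ℕ.* exponent k₁ k₂ k₃ k₄)))  ≈⟨ sum-over-j-innermost ⟩
      Σ⁴ (λ k₁ k₂ k₃ k₄ → Σ< N (λ j → X k₁ k₂ k₃ k₄ * ω^ (j ℕ.* exponent k₁ k₂ k₃ k₄)))
        ≈⟨ Σ⁴-cong (λ k₁ k₂ k₃ k₄ → trans (sym (*-distribˡ-Σ< N _ _)) (*-congˡ (ω-root.orthogonality (exponent k₁ k₂ k₃ k₄)))) ⟩
      Σ⁴ (λ k₁ k₂ k₃ k₄ → X k₁ k₂ k₃ k₄ * (if exponent k₁ k₂ k₃ k₄ % N ≡ᵇ 0 then fromℕ N else 0#)) ∎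
      where
      sum-over-j-innermost : ∀ {f : ℕ → ℕ → ℕ → ℕ → ℕ → Carrier} →
        Σ< N (λ j → Σ⁴ (f j)) ≈ Σ⁴ (λ k₁ k₂ k₃ k₄ → Σ< N (λ j → f j k₁ k₂ k₃ k₄))
      sum-over-j-innermost =
        trans (Σ<-comm N N _) (Σ<-cong N (λ k₁ → trans (Σ<-comm N N _) (Σ<-cong N (λ k₂ →
          trans (Σ<-comm N N _) (Σ<-cong N (λ k₃ → Σ<-comm N N _))))))

    k₃-solution : ℕ → ℕ → ℕ → ℕ
    k₃-solution k₁ k₂ k₄ = linear-part k₁ k₂ k₄ % N

    -- 1 + 2q ≡ -1 modulo N, so r + (1 + 2q) k ≡ 0 exactly when k ≡ r.
    exponent-vanishes⇒ : ∀ r k → k < N → ((r ℕ.+ (1 ℕ.+ 2 ℕ.* q) ℕ.* k) % N ≡ᵇ 0) ≡ true → k ≡ r % N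
    exponent-vanishes⇒ r k k<N vanishes = ≡.sym (ℤₙ.≋⇒≡-below (m%n<n r N) k<N (ℤₙ-Reasoning.begin
      r % N                                   ℤₙ-Reasoning.≈⟨ ℤₙ.%≋ r ⟩
      r                                       ℤₙ-Reasoning.≈⟨ ℤₙ.+multiple≋ r k ⟨
      r ℕ.+ k ℕ.* N                           ℤₙ-Reasoning.≡⟨ regroup q r k ⟨
      r ℕ.+ (1 ℕ.+ 2 ℕ.* q) ℕ.* k ℕ.+ k       ℤₙ-Reasoning.≈⟨ ℤₙ.+≋ʳ k (ℤₙ.mk≋ (≡ᵇ⇒≡ vanishes)) ⟩
      0 ℕ.+ k                                 ℤₙ-Reasoning.∎))
      where
      regroup : ∀ q r k → r ℕ.+ (1 ℕ.+ 2 ℕ.* q) ℕ.* k ℕ.+ k ≡ r ℕ.+ k ℕ.* (2 ℕ.+ 2 ℕ.* q)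
      regroup = solve-∀

    exponent-vanishes⇐ : ∀ r → ((r ℕ.+ (1 ℕ.+ 2 ℕ.* q) ℕ.* (r % N)) % N ≡ᵇ 0) ≡ true
    exponent-vanishes⇐ r = ≡⇒≡ᵇ (ℤₙ.un≋ (ℤₙ-Reasoning.begin
      r ℕ.+ (1 ℕ.+ 2 ℕ.* q) ℕ.* (r % N)       ℤₙ-Reasoning.≈⟨ ℤₙ.+≋ʳ _ (ℤₙ.%≋ r) ⟨
      r % N ℕ.+ (1 ℕ.+ 2 ℕ.* q) ℕ.* (r % N)   ℤₙ-Reasoning.≡⟨ regroup q (r % N) ⟩
      r % N ℕ.* N                             ℤₙ-Reasoning.≈⟨ ℤₙ.multiple≋0 (r % N) ⟩
      0                                       ℤₙ-Reasoning.∎))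
      where
      regroup : ∀ q r → r ℕ.+ (1 ℕ.+ 2 ℕ.* q) ℕ.* r ≡ r ℕ.* (2 ℕ.+ 2 ℕ.* q)
      regroup = solve-∀

    A≈Σ³ : A ≈ Σ< N (λ k₁ → Σ< N (λ k₂ → Σ< N (λ k₄ → X k₁ k₂ (k₃-solution k₁ k₂ k₄) k₄ * fromℕ N)))
    A≈Σ³ = trans A≈Σ⁴-constrained (Σ<-cong N (λ k₁ → Σ<-cong N (λ k₂ → trans (Σ<-comm N N _) (Σ<-cong N (λ k₄ →
      trans (Σ<-cong N (λ k₃ → if-*ˡ _ _ _))
            (Σ<-select N _ (λ k₃ → X k₁ k₂ k₃ k₄ * fromℕ N) (k₃-solution k₁ k₂ k₄) (m%n<n (linear-part k₁ k₂ k₄) N)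
                       (exponent-vanishes⇐ (linear-part k₁ k₂ k₄))
                       (λ k₃ k₃<N → exponent-vanishes⇒ (linear-part k₁ k₂ k₄) k₃ k₃<N)))))))

    λ-part : ℕ → ℕ → ℕ
    λ-part k₁ k₂ = n₁ ℕ.* k₁ ℕ.+ (1 ℕ.+ 2 ℕ.* q) ℕ.* n ℕ.* k₂ ℕ.+ (1 ℕ.+ 2 ℕ.* q) ℕ.* log-αt

    B : ℕ → ℕ → Carrier
    B k₁ k₂ = ω^ (h ℕ.* k₁) * ζ^ (γ k₁) * ζ^ (γ k₂)

    A≈Σ² : A ≈ Σ< N (λ k₁ → Σ< N (λ k₂ →
                 fromℕ N * B k₁ k₂ * (ω^ (h ℕ.* λ-part k₁ k₂) * G * ζ-shift (λ-part k₁ k₂) - 1#)))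
    A≈Σ² = trans A≈Σ³ (Σ<-cong N (λ k₁ → Σ<-cong N (λ k₂ → begin
      Σ< N (λ k₄ → X k₁ k₂ (k₃-solution k₁ k₂ k₄) k₄ * fromℕ N)
        ≈⟨ Σ<-cong N (factor k₁ k₂) ⟩
      Σ< N (λ k₄ → fromℕ N * B k₁ k₂ * ζ^ (g ℕ.^ (λ-part k₁ k₂ ℕ.+ (k₄ ℕ.+ k₄)) ℕ.+ γ k₄))
        ≈⟨ *-distribˡ-Σ< N _ _ ⟨
      fromℕ N * B k₁ k₂ * Σ< N (λ k₄ → ζ^ (g ℕ.^ (λ-part k₁ k₂ ℕ.+ (k₄ ℕ.+ k₄)) ℕ.+ γ k₄))
        ≈⟨ *-congˡ (Σ<-quadratic-exponent (λ-part k₁ k₂)) ⟩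
      fromℕ N * B k₁ k₂ * (ω^ (h ℕ.* λ-part k₁ k₂) * G * ζ-shift (λ-part k₁ k₂) - 1#) ∎)))
      where
      factor : ∀ k₁ k₂ k₄ → X k₁ k₂ (k₃-solution k₁ k₂ k₄) k₄ * fromℕ N
                              ≈ fromℕ N * B k₁ k₂ * ζ^ (g ℕ.^ (λ-part k₁ k₂ ℕ.+ (k₄ ℕ.+ k₄)) ℕ.+ γ k₄)
      factor k₁ k₂ k₄ = begin
        X k₁ k₂ k₃ k₄ * fromℕ N
          ≈⟨ solve 6 (λ a b₁ b₂ b₃ b₄ c → (a ⊛ (((b₁ ⊛ b₂) ⊛ b₃) ⊛ b₄)) ⊛ c ⊜ (c ⊛ ((a ⊛ b₁) ⊛ b₂)) ⊛ (b₃ ⊛ b₄))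
                   refl (ω^ (h ℕ.* k₁)) (ζ^ (γ k₁)) (ζ^ (γ k₂)) (ζ^ (γ k₃)) (ζ^ (γ k₄)) (fromℕ N) ⟩
        fromℕ N * B k₁ k₂ * (ζ^ (γ k₃) * ζ^ (γ k₄))
          ≈⟨ *-congˡ (sym (ζ^-homo (γ k₃) (γ k₄))) ⟩
        fromℕ N * B k₁ k₂ * ζ^ (γ k₃ ℕ.+ γ k₄)
          ≈⟨ *-congˡ (ζ^-cong (𝔽ₚ.+≋ʳ (γ k₄) γk₃≋)) ⟩
        fromℕ N * B k₁ k₂ * ζ^ (g ℕ.^ (λ-part k₁ k₂ ℕ.+ (k₄ ℕ.+ k₄)) ℕ.+ γ k₄) ∎
        where
        k₃ : ℕ
        k₃ = k₃-solution k₁ k₂ k₄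
        regroup : ∀ q n₁ k₁ k₂ k₄ l →
          n₁ ℕ.* k₁ ℕ.+ (1 ℕ.+ 2 ℕ.* q) ℕ.* suc n₁ ℕ.* k₂ ℕ.+ 2 ℕ.* k₄ ℕ.+ (1 ℕ.+ 2 ℕ.* q) ℕ.* l
            ≡ n₁ ℕ.* k₁ ℕ.+ (1 ℕ.+ 2 ℕ.* q) ℕ.* suc n₁ ℕ.* k₂ ℕ.+ (1 ℕ.+ 2 ℕ.* q) ℕ.* l ℕ.+ (k₄ ℕ.+ k₄)
        regroup = solve-∀
        γk₃≋ : γ k₃ ≋ g ℕ.^ (λ-part k₁ k₂ ℕ.+ (k₄ ℕ.+ k₄))
        γk₃≋ = ≋-trans (γ≋ k₃) (≋-trans (g^-cong (ℤₙ.%≋ (linear-part k₁ k₂ k₄)))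
                                          (≡⇒≋ (≡.cong (g ℕ.^_) (regroup q n₁ k₁ k₂ k₄ log-αt))))

    Σ<-ζ^γ : Σ< N (λ k → ζ^ (γ k)) ≈ - 1#
    Σ<-ζ^γ = trans (x+1≈y⇒x≈y-1 (trans (+-congʳ (Σ<-cong N (λ k → ^ᴿ-congʳ ζ (≡.sym (ℕₚ.*-identityʳ (γ k))))))
                                        (ζ-units 1)))
                   (+-identityˡ (- 1#))

    T-summand : ℕ → ℕ → Carrier
    T-summand k₁ k₂ = ω^ (h ℕ.* k₁) * ω^ (h ℕ.* λ-part k₁ k₂) * ζ^ (γ k₁) * ζ^ (γ k₂) * ζ-shift (λ-part k₁ k₂)

    T : Carrier
    T = Σ< N (λ k₁ → Σ< N (T-summand k₁))

    A≈NGT+NG : A ≈ fromℕ N * G * T + fromℕ N * G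
    A≈NGT+NG = begin
      A ≈⟨ A≈Σ² ⟩
      Σ< N (λ k₁ → Σ< N (λ k₂ → fromℕ N * B k₁ k₂ * (ω^ (h ℕ.* λ-part k₁ k₂) * G * ζ-shift (λ-part k₁ k₂) - 1#)))
        ≈⟨ Σ<-cong N (λ k₁ → Σ<-cong N (split k₁)) ⟩
      Σ< N (λ k₁ → Σ< N (λ k₂ → fromℕ N * G * T-summand k₁ k₂ + - (fromℕ N * B k₁ k₂)))
        ≈⟨ trans (Σ<-cong N (λ k₁ → Σ<-distrib-+ N _ _)) (Σ<-distrib-+ N _ _) ⟩
      Σ< N (λ k₁ → Σ< N (λ k₂ → fromℕ N * G * T-summand k₁ k₂)) + Σ< N (λ k₁ → Σ< N (λ k₂ → - (fromℕ N * B k₁ k₂)))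
        ≈⟨ +-cong (trans (Σ<-cong N (λ k₁ → sym (*-distribˡ-Σ< N _ _))) (sym (*-distribˡ-Σ< N _ _)))
                  (trans (Σ<-cong N (λ k₁ → trans (Σ<-neg N _) (-‿cong (sym (*-distribˡ-Σ< N _ _)))))
                         (trans (Σ<-neg N _) (-‿cong (sym (*-distribˡ-Σ< N _ _))))) ⟩
      fromℕ N * G * T + - (fromℕ N * Σ< N (λ k₁ → Σ< N (B k₁)))
        ≈⟨ +-congˡ (-‿cong (*-congˡ ΣΣB≈-G)) ⟩
      fromℕ N * G * T + - (fromℕ N * - G)
        ≈⟨ +-congˡ (trans (-‿cong (sym (-‿distribʳ-* _ _))) (-‿involutive _)) ⟩
      fromℕ N * G * T + fromℕ N * G ∎
      where
      split : ∀ k₁ k₂ → fromℕ N * B k₁ k₂ * (ω^ (h ℕ.* λ-part k₁ k₂) * G * ζ-shift (λ-part k₁ k₂) - 1#)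
                          ≈ fromℕ N * G * T-summand k₁ k₂ + - (fromℕ N * B k₁ k₂)
      split k₁ k₂ = trans (distribˡ _ _ _) (+-cong
        (solve 7 (λ a b₁ b₂ b₃ c₁ c₂ c₃ → (a ⊛ ((b₁ ⊛ b₂) ⊛ b₃)) ⊛ ((c₁ ⊛ c₂) ⊛ c₃)
                                           ⊜ (a ⊛ c₂) ⊛ ((((b₁ ⊛ c₁) ⊛ b₂) ⊛ b₃) ⊛ c₃))
               refl (fromℕ N) (ω^ (h ℕ.* k₁)) (ζ^ (γ k₁)) (ζ^ (γ k₂)) (ω^ (h ℕ.* λ-part k₁ k₂)) G (ζ-shift (λ-part k₁ k₂)))
        (x*-1≈-x _))
      ΣΣB≈-G : Σ< N (λ k₁ → Σ< N (B k₁)) ≈ - G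
      ΣΣB≈-G = begin
        Σ< N (λ k₁ → Σ< N (B k₁))                                    ≈⟨ Σ<-cong N (λ k₁ → sym (*-distribˡ-Σ< N _ _)) ⟩
        Σ< N (λ k₁ → ω^ (h ℕ.* k₁) * ζ^ (γ k₁) * Σ< N (λ k → ζ^ (γ k))) ≈⟨ *-distribʳ-Σ< N _ _ ⟨
        G * Σ< N (λ k → ζ^ (γ k))                                    ≈⟨ *-congˡ Σ<-ζ^γ ⟩
        G * - 1#                                                     ≈⟨ x*-1≈-x G ⟩
        - G                                                          ∎

    g^log-αt : g ℕ.^ log-αt ≋ α ℕ.* t
    g^log-αt = g^log αt-unit

    recip4 : ℕ
    recip4 = recip 4

    -- For x = g^s this is 1 + x - x^n α t / 4; it vanishes exactly when -1/x is a root of f_t.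
    M : ℕ → ℕ
    M x = 1 ℕ.+ x ℕ.+ negate (recip4 ℕ.* x ℕ.^ n ℕ.* (α ℕ.* t))

    W : ℕ → Carrier
    W s = ω^ (h ℕ.* (s ℕ.* n ℕ.+ log-αt))

    λ-part-shifted : ∀ k₁ s → λ-part k₁ ((s ℕ.+ k₁) % N) ℤₙ.≋ λ-part k₁ (s ℕ.+ k₁)
    λ-part-shifted k₁ s = ℤₙ.+≋ʳ _ (ℤₙ.+≋ˡ (n₁ ℕ.* k₁) (ℤₙ.*≋ˡ ((1 ℕ.+ 2 ℕ.* q) ℕ.* n) (ℤₙ.%≋ (s ℕ.+ k₁))))

    ω-exponent-shifted : ∀ k₁ s → h ℕ.* k₁ ℕ.+ h ℕ.* λ-part k₁ ((s ℕ.+ k₁) % N) ℤₙ.≋ h ℕ.* (s ℕ.* n ℕ.+ log-αt)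
    ω-exponent-shifted k₁ s = ℤₙ.≋-trans (ℤₙ.+≋ˡ (h ℕ.* k₁) (ℤₙ.*≋ˡ h (λ-part-shifted k₁ s)))
                                (ℤₙ.≋-trans (ℤₙ.≡⇒≋ (regroup q n₁ k₁ s log-αt))
                                             (ℤₙ.+multiple≋ _ (suc q ℕ.* n ℕ.* k₁ ℕ.+ q ℕ.* (s ℕ.* n ℕ.+ log-αt))))
      where
      regroup : ∀ q n₁ k₁ s l →
        suc q ℕ.* k₁ ℕ.+ suc q ℕ.* (n₁ ℕ.* k₁ ℕ.+ (1 ℕ.+ 2 ℕ.* q) ℕ.* suc n₁ ℕ.* (s ℕ.+ k₁) ℕ.+ (1 ℕ.+ 2 ℕ.* q) ℕ.* l)
          ≡ suc q ℕ.* (s ℕ.* suc n₁ ℕ.+ l)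
            ℕ.+ (suc q ℕ.* suc n₁ ℕ.* k₁ ℕ.+ q ℕ.* (s ℕ.* suc n₁ ℕ.+ l)) ℕ.* (2 ℕ.+ 2 ℕ.* q)
      regroup = solve-∀

    recip[4g^λ]-shifted : ∀ k₁ s → recip (4 ℕ.* g ℕ.^ λ-part k₁ ((s ℕ.+ k₁) % N)) ≋ recip4 ℕ.* γ k₁ ℕ.* γ s ℕ.^ n ℕ.* (α ℕ.* t)
    recip[4g^λ]-shifted k₁ s = 𝔽-Reasoning.begin
      recip (4 ℕ.* g ℕ.^ l)                      𝔽-Reasoning.≡⟨ ^-distribʳ-* 4 (g ℕ.^ l) (1 ℕ.+ 2 ℕ.* q) ⟩
      recip4 ℕ.* recip (g ℕ.^ l)                 𝔽-Reasoning.≡⟨ ≡.cong (recip4 ℕ.*_) (ℕₚ.^-*-assoc g l (1 ℕ.+ 2 ℕ.* q)) ⟩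
      recip4 ℕ.* g ℕ.^ (l ℕ.* (1 ℕ.+ 2 ℕ.* q))   𝔽-Reasoning.≈⟨ 𝔽ₚ.*≋ˡ recip4 (g^-cong l/[p-2]≋) ⟩
      recip4 ℕ.* g ℕ.^ (k₁ ℕ.+ s ℕ.* n ℕ.+ log-αt)
        𝔽-Reasoning.≡⟨ ≡.cong (recip4 ℕ.*_) (≡.trans (ℕₚ.^-distribˡ-+-* g (k₁ ℕ.+ s ℕ.* n) log-αt)
                         (≡.cong (ℕ._* g ℕ.^ log-αt) (≡.trans (ℕₚ.^-distribˡ-+-* g k₁ (s ℕ.* n))
                                                               (≡.cong (g ℕ.^ k₁ ℕ.*_) (≡.sym (ℕₚ.^-*-assoc g s n)))))) ⟩
      recip4 ℕ.* (g ℕ.^ k₁ ℕ.* (g ℕ.^ s) ℕ.^ n ℕ.* g ℕ.^ log-αt)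
        𝔽-Reasoning.≈⟨ 𝔽ₚ.*≋ˡ recip4 (𝔽ₚ.*≋ (𝔽ₚ.*≋ (≋-sym (γ≋ k₁)) (𝔽ₚ.^≋ n (≋-sym (γ≋ s)))) g^log-αt) ⟩
      recip4 ℕ.* (γ k₁ ℕ.* γ s ℕ.^ n ℕ.* (α ℕ.* t))
        𝔽-Reasoning.≡⟨ ≡.trans (≡.sym (ℕₚ.*-assoc recip4 _ _)) (≡.cong (ℕ._* (α ℕ.* t)) (≡.sym (ℕₚ.*-assoc recip4 _ _))) ⟩
      recip4 ℕ.* γ k₁ ℕ.* γ s ℕ.^ n ℕ.* (α ℕ.* t) 𝔽-Reasoning.∎
      where
      l : ℕ
      l = λ-part k₁ ((s ℕ.+ k₁) % N)
      regroup : ∀ q n₁ k₁ s l →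
        (n₁ ℕ.* k₁ ℕ.+ (1 ℕ.+ 2 ℕ.* q) ℕ.* suc n₁ ℕ.* (s ℕ.+ k₁) ℕ.+ (1 ℕ.+ 2 ℕ.* q) ℕ.* l) ℕ.* (1 ℕ.+ 2 ℕ.* q)
          ≡ k₁ ℕ.+ s ℕ.* suc n₁ ℕ.+ l
            ℕ.+ (n₁ ℕ.* k₁ ℕ.+ 2 ℕ.* q ℕ.* suc n₁ ℕ.* k₁ ℕ.+ 2 ℕ.* q ℕ.* (s ℕ.* suc n₁ ℕ.+ l)) ℕ.* (2 ℕ.+ 2 ℕ.* q)
      regroup = solve-∀
      l/[p-2]≋ : l ℕ.* (1 ℕ.+ 2 ℕ.* q) ℤₙ.≋ k₁ ℕ.+ s ℕ.* n ℕ.+ log-αt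
      l/[p-2]≋ = ℤₙ.≋-trans (ℤₙ.*≋ʳ (1 ℕ.+ 2 ℕ.* q) (λ-part-shifted k₁ s))
                   (ℤₙ.≋-trans (ℤₙ.≡⇒≋ (regroup q n₁ k₁ s log-αt))
                     (ℤₙ.+multiple≋ _ (n₁ ℕ.* k₁ ℕ.+ 2 ℕ.* q ℕ.* n ℕ.* k₁ ℕ.+ 2 ℕ.* q ℕ.* (s ℕ.* n ℕ.+ log-αt))))

    ζ-exponent-shifted : ∀ k₁ s →
      γ k₁ ℕ.+ (γ ((s ℕ.+ k₁) % N) ℕ.+ negate (recip (4 ℕ.* g ℕ.^ λ-part k₁ ((s ℕ.+ k₁) % N)))) ≋ γ k₁ ℕ.* M (γ s)
    ζ-exponent-shifted k₁ s = 𝔽-Reasoning.begin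
      γ k₁ ℕ.+ (γ k₂ ℕ.+ negate (recip (4 ℕ.* g ℕ.^ λ-part k₁ k₂)))
        𝔽-Reasoning.≈⟨ 𝔽ₚ.+≋ˡ (γ k₁) (𝔽ₚ.+≋ γk₂≋ (𝔽ₚ.*≋ˡ minus-one (recip[4g^λ]-shifted k₁ s))) ⟩
      γ k₁ ℕ.+ (γ k₁ ℕ.* γ s ℕ.+ negate (recip4 ℕ.* γ k₁ ℕ.* γ s ℕ.^ n ℕ.* (α ℕ.* t)))
        𝔽-Reasoning.≡⟨ factor-out q (γ k₁) (γ s) recip4 (γ s ℕ.^ n) (α ℕ.* t) ⟩
      γ k₁ ℕ.* M (γ s) 𝔽-Reasoning.∎
      where
      k₂ : ℕ
      k₂ = (s ℕ.+ k₁) % N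
      γk₂≋ : γ k₂ ≋ γ k₁ ℕ.* γ s
      γk₂≋ = 𝔽-Reasoning.begin
        γ k₂                  𝔽-Reasoning.≈⟨ γ≋ k₂ ⟩
        g ℕ.^ k₂              𝔽-Reasoning.≈⟨ g^-cong (ℤₙ.%≋ (s ℕ.+ k₁)) ⟩
        g ℕ.^ (s ℕ.+ k₁)      𝔽-Reasoning.≡⟨ ≡.trans (ℕₚ.^-distribˡ-+-* g s k₁) (ℕₚ.*-comm (g ℕ.^ s) (g ℕ.^ k₁)) ⟩
        g ℕ.^ k₁ ℕ.* g ℕ.^ s  𝔽-Reasoning.≈⟨ 𝔽ₚ.*≋ (≋-sym (γ≋ k₁)) (≋-sym (γ≋ s)) ⟩
        γ k₁ ℕ.* γ s          𝔽-Reasoning.∎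
      factor-out : ∀ q a b c d e → a ℕ.+ (a ℕ.* b ℕ.+ (2 ℕ.+ 2 ℕ.* q) ℕ.* (c ℕ.* a ℕ.* d ℕ.* e))
                                     ≡ a ℕ.* (1 ℕ.+ b ℕ.+ (2 ℕ.+ 2 ℕ.* q) ℕ.* (c ℕ.* d ℕ.* e))
      factor-out = solve-∀

    T-summand-shifted : ∀ k₁ s → T-summand k₁ ((s ℕ.+ k₁) % N) ≈ W s * ζ^ (γ k₁ ℕ.* M (γ s))
    T-summand-shifted k₁ s = begin
      ω^ (h ℕ.* k₁) * ω^ (h ℕ.* l) * ζ^ (γ k₁) * ζ^ (γ k₂) * ζ-shift l
        ≈⟨ solve 5 (λ a₁ a₂ b₁ b₂ b₃ → (((a₁ ⊛ a₂) ⊛ b₁) ⊛ b₂) ⊛ b₃ ⊜ (a₁ ⊛ a₂) ⊛ (b₁ ⊛ (b₂ ⊛ b₃)))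
                 refl (ω^ (h ℕ.* k₁)) (ω^ (h ℕ.* l)) (ζ^ (γ k₁)) (ζ^ (γ k₂)) (ζ-shift l) ⟩
      (ω^ (h ℕ.* k₁) * ω^ (h ℕ.* l)) * (ζ^ (γ k₁) * (ζ^ (γ k₂) * ζ-shift l))
        ≈⟨ *-cong (sym (ω^-homo (h ℕ.* k₁) (h ℕ.* l))) (trans (*-congˡ (sym (ζ^-homo (γ k₂) _))) (sym (ζ^-homo (γ k₁) _))) ⟩
      ω^ (h ℕ.* k₁ ℕ.+ h ℕ.* l) * ζ^ (γ k₁ ℕ.+ (γ k₂ ℕ.+ negate (recip (4 ℕ.* g ℕ.^ l))))
        ≈⟨ *-cong (ω^-cong (ω-exponent-shifted k₁ s)) (ζ^-cong (ζ-exponent-shifted k₁ s)) ⟩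
      W s * ζ^ (γ k₁ ℕ.* M (γ s)) ∎
      where
      k₂ l : ℕ
      k₂ = (s ℕ.+ k₁) % N
      l = λ-part k₁ k₂

    M-vanishes : ℕ → Bool
    M-vanishes s = M (γ s) % p ≡ᵇ 0

    P : ℕ → Carrier
    P s = if M-vanishes s then fromℕ p else 0#

    T≈ΣW[P-1] : T ≈ Σ< N (λ s → W s * (P s - 1#))
    T≈ΣW[P-1] = begin
      T                                                     ≈⟨ Σ<-cong N (λ k₁ → sym (Σ<-shift k₁ (T-summand k₁))) ⟩
      Σ< N (λ k₁ → Σ< N (λ s → T-summand k₁ ((s ℕ.+ k₁) % N)))  ≈⟨ Σ<-cong N (λ k₁ → Σ<-cong N (T-summand-shifted k₁)) ⟩
      Σ< N (λ k₁ → Σ< N (λ s → W s * ζ^ (γ k₁ ℕ.* M (γ s))))    ≈⟨ Σ<-comm N N _ ⟩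
      Σ< N (λ s → Σ< N (λ k₁ → W s * ζ^ (γ k₁ ℕ.* M (γ s))))    ≈⟨ Σ<-cong N (λ s → sym (*-distribˡ-Σ< N _ _)) ⟩
      Σ< N (λ s → W s * Σ< N (λ k₁ → ζ^ (γ k₁ ℕ.* M (γ s))))    ≈⟨ Σ<-cong N (λ s → *-congˡ (x+1≈y⇒x≈y-1 (ζ-units (M (γ s))))) ⟩
      Σ< N (λ s → W s * (P s - 1#))                             ∎

    ΣW-in-pairs : Σ< N W ≈ Σ< h (λ _ → ω^ (h ℕ.* log-αt) + ω^ (h ℕ.* n) * ω^ (h ℕ.* log-αt))
    ΣW-in-pairs = begin
      Σ< N W                   ≈⟨ Σ<-length W (≡.sym h+h≡N) ⟩
      Σ< (h ℕ.+ h) W           ≈⟨ Σ<-even-odd h W ⟩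
      Σ< h (λ m → W (2 ℕ.* m) + W (suc (2 ℕ.* m)))  ≈⟨ Σ<-cong h (λ m → +-cong (W-even m) (W-odd m)) ⟩
      Σ< h (λ _ → ω^ (h ℕ.* log-αt) + ω^ (h ℕ.* n) * ω^ (h ℕ.* log-αt)) ∎
      where
      W-even : ∀ m → W (2 ℕ.* m) ≈ ω^ (h ℕ.* log-αt)
      W-even m = ω^-cong (ℤₙ.≋-trans (ℤₙ.≡⇒≋ (regroup h m n log-αt)) (+hh≋ (h ℕ.* log-αt) (m ℕ.* n)))
        where
        regroup : ∀ h m n l → h ℕ.* ((2 ℕ.* m) ℕ.* n ℕ.+ l) ≡ h ℕ.* l ℕ.+ (h ℕ.+ h) ℕ.* (m ℕ.* n)
        regroup = solve-∀
      W-odd : ∀ m → W (suc (2 ℕ.* m)) ≈ ω^ (h ℕ.* n) * ω^ (h ℕ.* log-αt)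
      W-odd m = trans (ω^-cong (ℤₙ.≋-trans (ℤₙ.≡⇒≋ (regroup h m n log-αt)) (+hh≋ (h ℕ.* n ℕ.+ h ℕ.* log-αt) (m ℕ.* n))))
                      (ω^-homo (h ℕ.* n) (h ℕ.* log-αt))
        where
        regroup : ∀ h m n l → h ℕ.* (suc (2 ℕ.* m) ℕ.* n ℕ.+ l) ≡ (h ℕ.* n ℕ.+ h ℕ.* l) ℕ.+ (h ℕ.+ h) ℕ.* (m ℕ.* n)
        regroup = solve-∀

    ΣW-even : ∀ k → n ≡ 2 ℕ.* k → Σ< N W ≈ fromℕ N * ω^ (h ℕ.* log-αt)
    ΣW-even k n≡2k = begin
      Σ< N W                                     ≈⟨ ΣW-in-pairs ⟩
      Σ< h (λ _ → w + ω^ (h ℕ.* n) * w)          ≈⟨ Σ<-cong h (λ _ → +-congˡ (trans (*-congʳ ω^hn≈1) (*-identityˡ w))) ⟩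
      Σ< h (λ _ → w + w)                         ≈⟨ Σ<-distrib-+ h _ _ ⟩
      Σ< h (λ _ → w) + Σ< h (λ _ → w)            ≈⟨ Σ<-split h h (λ _ → w) ⟨
      Σ< (h ℕ.+ h) (λ _ → w)                     ≈⟨ Σ<-length (λ _ → w) h+h≡N ⟩
      Σ< N (λ _ → w)                             ≈⟨ Σ<-const N w ⟩
      fromℕ N * w                                ∎
      where
      w : Carrier
      w = ω^ (h ℕ.* log-αt)
      ω^hn≈1 : ω^ (h ℕ.* n) ≈ 1#
      ω^hn≈1 = trans (^ᴿ-congʳ ω (≡.cong (h ℕ.*_) n≡2k)) (ω^h-even k)

    ΣW-odd : ∀ k → n ≡ suc (2 ℕ.* k) → Σ< N W ≈ 0#
    ΣW-odd k n≡2k+1 = begin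
      Σ< N W                                     ≈⟨ ΣW-in-pairs ⟩
      Σ< h (λ _ → w + ω^ (h ℕ.* n) * w)          ≈⟨ Σ<-cong h (λ _ → trans (+-congˡ (trans (*-congʳ ω^hn≈-1) (-1*x≈-x w)))
                                                                          (-‿inverseʳ w)) ⟩
      Σ< h (λ _ → 0#)                            ≈⟨ Σ<-zero h ⟩
      0#                                         ∎
      where
      w : Carrier
      w = ω^ (h ℕ.* log-αt)
      ω^hn≈-1 : ω^ (h ℕ.* n) ≈ - 1#
      ω^hn≈-1 = trans (^ᴿ-congʳ ω (≡.cong (h ℕ.*_) n≡2k+1)) (ω^h-odd k)

    αt-exponent : ℕ
    αt-exponent = log₂ ℕ.+ log₂ ℕ.+ log oneMinusN ℕ.* n₁ ℕ.+ log n ℕ.* n ℕ.* (1 ℕ.+ 2 ℕ.* q) ℕ.+ log t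

    g^αt-exponent≋αt : g ℕ.^ αt-exponent ≋ α ℕ.* t
    g^αt-exponent≋αt = 𝔽-Reasoning.begin
      g ℕ.^ αt-exponent
        𝔽-Reasoning.≡⟨ split-exponent ⟩
      g ℕ.^ log₂ ℕ.* g ℕ.^ log₂ ℕ.* (g ℕ.^ log-1-n) ℕ.^ n₁ ℕ.* ((g ℕ.^ log-n) ℕ.^ n) ℕ.^ (1 ℕ.+ 2 ℕ.* q) ℕ.* g ℕ.^ log-t
        𝔽-Reasoning.≈⟨ 𝔽ₚ.*≋ (𝔽ₚ.*≋ (𝔽ₚ.*≋ (𝔽ₚ.*≋ g^log₂ g^log₂) (𝔽ₚ.^≋ n₁ (g^log 1-n-unit)))
                                       (𝔽ₚ.^≋ (1 ℕ.+ 2 ℕ.* q) (𝔽ₚ.^≋ n (g^log n-unit)))) (g^log t-unit) ⟩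
      4 ℕ.* oneMinusN ℕ.^ n₁ ℕ.* recip (n ℕ.^ n) ℕ.* t
        𝔽-Reasoning.≈⟨ 𝔽ₚ.*≋ʳ t (≋-trans (𝔽ₚ.%≋ _) (𝔽ₚ.*≋ˡ (4 ℕ.* oneMinusN ℕ.^ n₁) (𝔽ₚ.%≋ _))) ⟨
      α ℕ.* t 𝔽-Reasoning.∎
      where
      log-1-n log-t log-n : ℕ
      log-1-n = log oneMinusN
      log-t = log t
      log-n = log n
      split-exponent : g ℕ.^ αt-exponent
        ≡ g ℕ.^ log₂ ℕ.* g ℕ.^ log₂ ℕ.* (g ℕ.^ log-1-n) ℕ.^ n₁ ℕ.* ((g ℕ.^ log-n) ℕ.^ n) ℕ.^ (1 ℕ.+ 2 ℕ.* q) ℕ.* g ℕ.^ log-t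
      split-exponent =
        ≡.trans (ℕₚ.^-distribˡ-+-* g (log₂ ℕ.+ log₂ ℕ.+ log-1-n ℕ.* n₁ ℕ.+ log-n ℕ.* n ℕ.* (1 ℕ.+ 2 ℕ.* q)) log-t)
          (≡.cong (ℕ._* g ℕ.^ log-t)
            (≡.trans (ℕₚ.^-distribˡ-+-* g (log₂ ℕ.+ log₂ ℕ.+ log-1-n ℕ.* n₁) (log-n ℕ.* n ℕ.* (1 ℕ.+ 2 ℕ.* q)))
              (≡.cong₂ ℕ._*_
                (≡.trans (ℕₚ.^-distribˡ-+-* g (log₂ ℕ.+ log₂) (log-1-n ℕ.* n₁))
                         (≡.cong₂ ℕ._*_ (ℕₚ.^-distribˡ-+-* g log₂ log₂) (≡.sym (ℕₚ.^-*-assoc g log-1-n n₁))))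
                (≡.trans (≡.sym (ℕₚ.^-*-assoc g (log-n ℕ.* n) (1 ℕ.+ 2 ℕ.* q)))
                         (≡.cong (ℕ._^ (1 ℕ.+ 2 ℕ.* q)) (≡.sym (ℕₚ.^-*-assoc g log-n n)))))))

    -- For odd n - 1 the factors 4 and n^n of α are squares, so φ(α t) = φ((1 - n) t).
    φ[1-n]t : ∀ k → n₁ ≡ suc (2 ℕ.* k) → φ (oneMinusN ℕ.* t) ≈ ω^ (h ℕ.* log-αt)
    φ[1-n]t k n₁≡2k+1 = begin
      chr φi (oneMinusN ℕ.* t)             ≈⟨ reflexive (≡.cong (λ i → chr i (oneMinusN ℕ.* t)) φi≡h) ⟩
      chr h (oneMinusN ℕ.* t)              ≈⟨ χ-exp h (oneMinusN ℕ.* t) (log-1-n ℕ.+ log-t) [1-n]t≋ ⟩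
      ω^ (h ℕ.* (log-1-n ℕ.+ log-t))       ≈⟨ ω^-cong (ℤₙ.≋-sym h·log-αt≋) ⟩
      ω^ (h ℕ.* log-αt)                    ∎
      where
      log-1-n log-t : ℕ
      log-1-n = log oneMinusN
      log-t = log t
      [1-n]t≋ : oneMinusN ℕ.* t ≋ g ℕ.^ (log-1-n ℕ.+ log-t)
      [1-n]t≋ = ≋-trans (𝔽ₚ.*≋ (≋-sym (g^log 1-n-unit)) (≋-sym (g^log t-unit))) (≡⇒≋ (≡.sym (ℕₚ.^-distribˡ-+-* g log-1-n log-t)))
      regroup : ∀ h q a lo ln lt k m → m ≡ suc (2 ℕ.* k) →
        h ℕ.* (a ℕ.+ a ℕ.+ lo ℕ.* m ℕ.+ ln ℕ.* suc m ℕ.* (1 ℕ.+ 2 ℕ.* q) ℕ.+ lt)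
          ≡ h ℕ.* (lo ℕ.+ lt) ℕ.+ (h ℕ.+ h) ℕ.* (a ℕ.+ lo ℕ.* k ℕ.+ ln ℕ.* suc k ℕ.* (1 ℕ.+ 2 ℕ.* q))
      regroup h q a lo ln lt k _ ≡.refl = odd-instance h q a lo ln lt k
        where
        odd-instance : ∀ h q a lo ln lt k →
          h ℕ.* (a ℕ.+ a ℕ.+ lo ℕ.* suc (2 ℕ.* k) ℕ.+ ln ℕ.* suc (suc (2 ℕ.* k)) ℕ.* (1 ℕ.+ 2 ℕ.* q) ℕ.+ lt)
            ≡ h ℕ.* (lo ℕ.+ lt) ℕ.+ (h ℕ.+ h) ℕ.* (a ℕ.+ lo ℕ.* k ℕ.+ ln ℕ.* suc k ℕ.* (1 ℕ.+ 2 ℕ.* q))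
        odd-instance = solve-∀
      h·log-αt≋ : h ℕ.* log-αt ℤₙ.≋ h ℕ.* (log-1-n ℕ.+ log-t)
      h·log-αt≋ = ℤₙ.≋-trans (ℤₙ.*≋ˡ h (log-≋ αt-exponent g^αt-exponent≋αt))
                    (ℤₙ.≋-trans (ℤₙ.≡⇒≋ (regroup h q log₂ log-1-n (log n) log-t k n₁ n₁≡2k+1)) (+hh≋ _ _))

    β≈1-ΣW : β ≈ 1# - Σ< N W
    β≈1-ΣW with n % 2 in n%2≡r | n / 2 in n/2≡k
    ... | zero | zero with div-mod-2 n n%2≡r n/2≡k
    ...   | ()
    β≈1-ΣW | zero | suc k =
      +-congˡ (-‿cong (trans (*-congˡ (φ[1-n]t k n₁≡2k+1)) (sym (ΣW-even (suc k) n≡2[k+1]))))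
      where
      n≡2[k+1] : n ≡ 2 ℕ.* suc k
      n≡2[k+1] = div-mod-2 n n%2≡r n/2≡k
      n₁≡2k+1 : n₁ ≡ suc (2 ℕ.* k)
      n₁≡2k+1 = ℕₚ.suc-injective (≡.trans n≡2[k+1] (2[k+1]≡ k))
        where
        2[k+1]≡ : ∀ k → 2 ℕ.* suc k ≡ suc (suc (2 ℕ.* k))
        2[k+1]≡ = solve-∀
    β≈1-ΣW | suc zero | k =
      sym (trans (+-congˡ (trans (-‿cong (ΣW-odd k (div-mod-2 n n%2≡r n/2≡k))) -0#≈0#)) (+-identityʳ 1#))
    β≈1-ΣW | suc (suc r) | _ with ≡.subst (ℕ._< 2) n%2≡r (m%n<n n 2)
    ...   | s≤s (s≤s ())

    recip-unique : ∀ {x y} → Unit x → x ℕ.* y ≋ 1 → y ≋ recip x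
    recip-unique {x} ux xy≋1 = 𝔽ₚ.cancelˡ (≋-trans xy≋1 (≋-sym (*-recip ux))) ux

    recip-unit : ∀ {x} → Unit x → Unit (recip x)
    recip-unit = 𝔽ₚ.unit-^ (1 ℕ.+ 2 ℕ.* q)

    recip-cong : ∀ {x y} → x ≋ y → recip x ≋ recip y
    recip-cong = 𝔽ₚ.^≋ (1 ℕ.+ 2 ℕ.* q)

    recip-involutive : ∀ {x} → Unit x → recip (recip x) ≋ x
    recip-involutive {x} ux = ≋-sym (recip-unique (recip-unit ux) (≋-trans (≡⇒≋ (ℕₚ.*-comm (recip x) x)) (*-recip ux)))

    minus-one²≋1 : minus-one ℕ.* minus-one ≋ 1
    minus-one²≋1 = ≋-trans (≡⇒≋ (regroup q)) (𝔽ₚ.+multiple≋ 1 (1 ℕ.+ 2 ℕ.* q))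
      where
      regroup : ∀ q → (2 ℕ.+ 2 ℕ.* q) ℕ.* (2 ℕ.+ 2 ℕ.* q) ≡ 1 ℕ.+ (1 ℕ.+ 2 ℕ.* q) ℕ.* (3 ℕ.+ 2 ℕ.* q)
      regroup = solve-∀

    -1/x : ℕ → ℕ
    -1/x x = minus-one ℕ.* recip x

    -1/x-unit : ∀ {x} → Unit x → Unit (-1/x x)
    -1/x-unit ux = 𝔽ₚ.unit-* minus-one-unit (recip-unit ux)

    x·-1/x : ∀ {x} → Unit x → x ℕ.* -1/x x ≋ minus-one
    x·-1/x {x} ux = ≋-trans (≡⇒≋ (ℕₚ.*-comm x (-1/x x)))
                      (≋-trans (≡⇒≋ (ℕₚ.*-assoc minus-one (recip x) x))
                        (≋-trans (𝔽ₚ.*≋ˡ minus-one (≋-trans (≡⇒≋ (ℕₚ.*-comm (recip x) x)) (*-recip ux)))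
                                 (≡⇒≋ (ℕₚ.*-identityʳ minus-one))))

    -1/x-involutive : ∀ {x} → Unit x → -1/x (-1/x x) ≋ x
    -1/x-involutive {x} ux = 𝔽-Reasoning.begin
      minus-one ℕ.* recip (minus-one ℕ.* recip x)          𝔽-Reasoning.≡⟨ ≡.cong (minus-one ℕ.*_) (^-distribʳ-* minus-one (recip x) (1 ℕ.+ 2 ℕ.* q)) ⟩
      minus-one ℕ.* (recip minus-one ℕ.* recip (recip x))  𝔽-Reasoning.≈⟨ 𝔽ₚ.*≋ˡ minus-one (𝔽ₚ.*≋ recip-minus-one (recip-involutive ux)) ⟩
      minus-one ℕ.* (minus-one ℕ.* x)                      𝔽-Reasoning.≡⟨ ℕₚ.*-assoc minus-one minus-one x ⟨
      minus-one ℕ.* minus-one ℕ.* x                        𝔽-Reasoning.≈⟨ 𝔽ₚ.*≋ʳ x minus-one²≋1 ⟩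
      1 ℕ.* x                                              𝔽-Reasoning.≡⟨ ℕₚ.*-identityˡ x ⟩
      x                                                    𝔽-Reasoning.∎
      where
      recip-minus-one : recip minus-one ≋ minus-one
      recip-minus-one = ≋-sym (recip-unique minus-one-unit minus-one²≋1)

    n₂ : ℕ
    n₂ = ℕ.pred n₁

    n₁≡1+n₂ : n₁ ≡ suc n₂
    n₁≡1+n₂ = ≡.sym (ℕₚ.suc-pred n₁ {{ℕ.≢-nonZero (λ n₁≡0 → n₁-unit (mk≋ (≡.cong (_% p) n₁≡0)))}})

    sign : ℕ
    sign = minus-one ℕ.^ n₁

    sign²≋1 : sign ℕ.* sign ≋ 1
    sign²≋1 = ≋-trans (≡⇒≋ (≡.sym (^-distribʳ-* minus-one minus-one n₁)))
                      (≋-trans (𝔽ₚ.^≋ n₁ minus-one²≋1) (≡⇒≋ (ℕₚ.^-zeroˡ n₁)))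

    C : ℕ
    C = cst ℕ.* t

    C-unit : Unit C
    C-unit = 𝔽ₚ.unit-* (𝔽ₚ.unit-resp-≋ (≋-sym (𝔽ₚ.%≋ _)) (𝔽ₚ.unit-* (𝔽ₚ.unit-^ n₁ n₁-unit) nninv-unit)) t-unit

    -- α/4 = (1 - n)^(n-1) / n^n = (-1)^(n-1) (n-1)^(n-1) / n^n
    α/4≋sign·cst : recip4 ℕ.* α ≋ sign ℕ.* cst
    α/4≋sign·cst = 𝔽-Reasoning.begin
      recip4 ℕ.* α                                        𝔽-Reasoning.≈⟨ 𝔽ₚ.*≋ˡ recip4 (𝔽ₚ.%≋ _) ⟩
      recip4 ℕ.* (4 ℕ.* oneMinusN ℕ.^ n₁ ℕ.* nninv)       𝔽-Reasoning.≈⟨ 𝔽ₚ.*≋ˡ recip4 (𝔽ₚ.*≋ʳ nninv (𝔽ₚ.*≋ˡ 4 (𝔽ₚ.^≋ n₁ 1-n≋-n₁))) ⟩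
      recip4 ℕ.* (4 ℕ.* (minus-one ℕ.* n₁) ℕ.^ n₁ ℕ.* nninv)
        𝔽-Reasoning.≡⟨ ≡.cong (λ z → recip4 ℕ.* (4 ℕ.* z ℕ.* nninv)) (^-distribʳ-* minus-one n₁ n₁) ⟩
      recip4 ℕ.* (4 ℕ.* (sign ℕ.* n₁ ℕ.^ n₁) ℕ.* nninv)   𝔽-Reasoning.≡⟨ regroup recip4 4 sign (n₁ ℕ.^ n₁) nninv ⟩
      (4 ℕ.* recip4) ℕ.* (sign ℕ.* (n₁ ℕ.^ n₁ ℕ.* nninv)) 𝔽-Reasoning.≈⟨ 𝔽ₚ.*≋ (*-recip (𝔽ₚ.unit-* 2-unit 2-unit)) (𝔽ₚ.*≋ˡ sign (≋-sym (𝔽ₚ.%≋ _))) ⟩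
      1 ℕ.* (sign ℕ.* cst)                                𝔽-Reasoning.≡⟨ ℕₚ.*-identityˡ _ ⟩
      sign ℕ.* cst                                        𝔽-Reasoning.∎
      where
      regroup : ∀ i f s m v → i ℕ.* (f ℕ.* (s ℕ.* m) ℕ.* v) ≡ (f ℕ.* i) ℕ.* (s ℕ.* (m ℕ.* v))
      regroup = solve-∀

    Z : ℕ → ℕ
    Z x = sign ℕ.* C ℕ.* x ℕ.^ n

    xⁿαt/4≋Z : ∀ x → recip4 ℕ.* x ℕ.^ n ℕ.* (α ℕ.* t) ≋ Z x
    xⁿαt/4≋Z x = ≋-trans (≡⇒≋ (regroup recip4 (x ℕ.^ n) α t))
                   (≋-trans (𝔽ₚ.*≋ʳ (t ℕ.* x ℕ.^ n) α/4≋sign·cst) (≡⇒≋ (regroup′ sign cst t (x ℕ.^ n))))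
      where
      regroup : ∀ i y a t → i ℕ.* y ℕ.* (a ℕ.* t) ≡ (i ℕ.* a) ℕ.* (t ℕ.* y)
      regroup = solve-∀
      regroup′ : ∀ s c t y → s ℕ.* c ℕ.* (t ℕ.* y) ≡ s ℕ.* (c ℕ.* t) ℕ.* y
      regroup′ = solve-∀

    M≋0⇒ : ∀ x → M x ≋ 0 → 1 ℕ.+ x ≋ Z x
    M≋0⇒ x Mx≋0 = 𝔽-Reasoning.begin
      1 ℕ.+ x                                 𝔽-Reasoning.≈⟨ ≋-trans (𝔽ₚ.+≋ˡ (1 ℕ.+ x) (negate-+ y)) (≡⇒≋ (ℕₚ.+-identityʳ _)) ⟨
      1 ℕ.+ x ℕ.+ (negate y ℕ.+ y)            𝔽-Reasoning.≡⟨ ℕₚ.+-assoc (1 ℕ.+ x) (negate y) y ⟨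
      M x ℕ.+ y                               𝔽-Reasoning.≈⟨ 𝔽ₚ.+≋ʳ y Mx≋0 ⟩
      y                                       𝔽-Reasoning.≈⟨ xⁿαt/4≋Z x ⟩
      Z x                                     𝔽-Reasoning.∎
      where
      y : ℕ
      y = recip4 ℕ.* x ℕ.^ n ℕ.* (α ℕ.* t)

    ⇒M≋0 : ∀ x → 1 ℕ.+ x ≋ Z x → M x ≋ 0
    ⇒M≋0 x 1+x≋Zx = ≋-trans (𝔽ₚ.+≋ʳ (negate y) (≋-trans 1+x≋Zx (≋-sym (xⁿαt/4≋Z x))))
                            (≋-trans (≡⇒≋ (ℕₚ.+-comm y (negate y))) (negate-+ y))
      where
      y : ℕ
      y = recip4 ℕ.* x ℕ.^ n ℕ.* (α ℕ.* t)

    -- For a = -1/x: multiplying f_t(a) = a^n - a^(n-1) + C by x^n gives -sign (1 + x) + C x^n.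
    module Reciprocal (a x : ℕ) (ax≋-1 : a ℕ.* x ≋ minus-one) (x-unit : Unit x) where
      aⁿ+C-scaled : (a ℕ.^ n ℕ.+ C) ℕ.* x ℕ.^ n ≋ minus-one ℕ.* sign ℕ.+ C ℕ.* x ℕ.^ n
      aⁿ+C-scaled = ≋-trans (≡⇒≋ (ℕₚ.*-distribʳ-+ (x ℕ.^ n) (a ℕ.^ n) C))
                      (𝔽ₚ.+≋ʳ (C ℕ.* x ℕ.^ n) (≋-trans (≡⇒≋ (≡.sym (^-distribʳ-* a x n))) (𝔽ₚ.^≋ n ax≋-1)))

      aⁿ⁻¹-scaled : a ℕ.^ n₁ ℕ.* x ℕ.^ n ≋ sign ℕ.* x
      aⁿ⁻¹-scaled = 𝔽-Reasoning.begin
        a ℕ.^ n₁ ℕ.* (x ℕ.* x ℕ.^ n₁)    𝔽-Reasoning.≡⟨ ℕₚ.*-comm (a ℕ.^ n₁) _ ⟩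
        (x ℕ.* x ℕ.^ n₁) ℕ.* a ℕ.^ n₁    𝔽-Reasoning.≡⟨ ℕₚ.*-assoc x (x ℕ.^ n₁) (a ℕ.^ n₁) ⟩
        x ℕ.* (x ℕ.^ n₁ ℕ.* a ℕ.^ n₁)    𝔽-Reasoning.≡⟨ ≡.cong (x ℕ.*_) (≡.sym (^-distribʳ-* x a n₁)) ⟩
        x ℕ.* (x ℕ.* a) ℕ.^ n₁           𝔽-Reasoning.≈⟨ 𝔽ₚ.*≋ˡ x (𝔽ₚ.^≋ n₁ (≋-trans (≡⇒≋ (ℕₚ.*-comm x a)) ax≋-1)) ⟩
        x ℕ.* sign                       𝔽-Reasoning.≡⟨ ℕₚ.*-comm x sign ⟩
        sign ℕ.* x                       𝔽-Reasoning.∎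

      Cxⁿ≋sign·Z : C ℕ.* x ℕ.^ n ≋ sign ℕ.* Z x
      Cxⁿ≋sign·Z = 𝔽-Reasoning.begin
        C ℕ.* x ℕ.^ n                    𝔽-Reasoning.≡⟨ ℕₚ.*-identityˡ _ ⟨
        1 ℕ.* (C ℕ.* x ℕ.^ n)            𝔽-Reasoning.≈⟨ 𝔽ₚ.*≋ʳ _ sign²≋1 ⟨
        sign ℕ.* sign ℕ.* (C ℕ.* x ℕ.^ n) 𝔽-Reasoning.≡⟨ ≡.trans (ℕₚ.*-assoc sign sign _) (≡.cong (sign ℕ.*_) (≡.sym (ℕₚ.*-assoc sign C _))) ⟩
        sign ℕ.* Z x                     𝔽-Reasoning.∎

      sign·[1+x] : ∀ y → sign ℕ.* (1 ℕ.+ y) ≡ sign ℕ.* y ℕ.+ sign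
      sign·[1+x] y = ≡.trans (ℕₚ.*-distribˡ-+ sign 1 y) (≡.trans (≡.cong (ℕ._+ sign ℕ.* y) (ℕₚ.*-identityʳ sign))
                                                                   (ℕₚ.+-comm sign (sign ℕ.* y)))

      M-zero⇒f-root : 1 ℕ.+ x ≋ Z x → a ℕ.^ n ℕ.+ C ≋ a ℕ.^ n₁
      M-zero⇒f-root 1+x≋Zx = 𝔽ₚ.cancelʳ (𝔽-Reasoning.begin
        (a ℕ.^ n ℕ.+ C) ℕ.* x ℕ.^ n                 𝔽-Reasoning.≈⟨ aⁿ+C-scaled ⟩
        minus-one ℕ.* sign ℕ.+ C ℕ.* x ℕ.^ n        𝔽-Reasoning.≈⟨ 𝔽ₚ.+≋ˡ (minus-one ℕ.* sign) (≋-trans Cxⁿ≋sign·Z (𝔽ₚ.*≋ˡ sign (≋-sym 1+x≋Zx))) ⟩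
        minus-one ℕ.* sign ℕ.+ sign ℕ.* (1 ℕ.+ x)   𝔽-Reasoning.≡⟨ ≡.cong (minus-one ℕ.* sign ℕ.+_) (sign·[1+x] x) ⟩
        minus-one ℕ.* sign ℕ.+ (sign ℕ.* x ℕ.+ sign)
          𝔽-Reasoning.≡⟨ ≡.trans (≡.cong (minus-one ℕ.* sign ℕ.+_) (ℕₚ.+-comm (sign ℕ.* x) sign))
                                 (≡.sym (ℕₚ.+-assoc (minus-one ℕ.* sign) sign (sign ℕ.* x))) ⟩
        negate sign ℕ.+ sign ℕ.+ sign ℕ.* x         𝔽-Reasoning.≈⟨ 𝔽ₚ.+≋ʳ (sign ℕ.* x) (negate-+ sign) ⟩
        sign ℕ.* x                                  𝔽-Reasoning.≈⟨ aⁿ⁻¹-scaled ⟨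
        a ℕ.^ n₁ ℕ.* x ℕ.^ n                        𝔽-Reasoning.∎) (𝔽ₚ.unit-^ n x-unit)

      f-root⇒M-zero : a ℕ.^ n ℕ.+ C ≋ a ℕ.^ n₁ → 1 ℕ.+ x ≋ Z x
      f-root⇒M-zero f-root = 𝔽-Reasoning.begin
        1 ℕ.+ x                            𝔽-Reasoning.≡⟨ ℕₚ.*-identityˡ _ ⟨
        1 ℕ.* (1 ℕ.+ x)                    𝔽-Reasoning.≈⟨ 𝔽ₚ.*≋ʳ _ sign²≋1 ⟨
        sign ℕ.* sign ℕ.* (1 ℕ.+ x)        𝔽-Reasoning.≡⟨ ≡.trans (ℕₚ.*-assoc sign sign _) (≡.cong (sign ℕ.*_) (sign·[1+x] x)) ⟩
        sign ℕ.* (sign ℕ.* x ℕ.+ sign)     𝔽-Reasoning.≈⟨ 𝔽ₚ.*≋ˡ sign Cxⁿ≋sign·[1+x] ⟨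
        sign ℕ.* (C ℕ.* x ℕ.^ n)           𝔽-Reasoning.≡⟨ ℕₚ.*-assoc sign C _ ⟨
        Z x                                𝔽-Reasoning.∎
        where
        scaled : minus-one ℕ.* sign ℕ.+ C ℕ.* x ℕ.^ n ≋ sign ℕ.* x
        scaled = ≋-trans (≋-sym aⁿ+C-scaled) (≋-trans (𝔽ₚ.*≋ʳ (x ℕ.^ n) f-root) aⁿ⁻¹-scaled)
        Cxⁿ≋sign·[1+x] : C ℕ.* x ℕ.^ n ≋ sign ℕ.* x ℕ.+ sign
        Cxⁿ≋sign·[1+x] = 𝔽-Reasoning.begin
          C ℕ.* x ℕ.^ n                                   𝔽-Reasoning.≈⟨ 𝔽ₚ.+≋ʳ (C ℕ.* x ℕ.^ n) (negate-+ sign) ⟨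
          negate sign ℕ.+ sign ℕ.+ C ℕ.* x ℕ.^ n          𝔽-Reasoning.≡⟨ regroup (negate sign) sign (C ℕ.* x ℕ.^ n) ⟩
          negate sign ℕ.+ C ℕ.* x ℕ.^ n ℕ.+ sign          𝔽-Reasoning.≈⟨ 𝔽ₚ.+≋ʳ sign scaled ⟩
          sign ℕ.* x ℕ.+ sign                             𝔽-Reasoning.∎
          where
          regroup : ∀ u v w → u ℕ.+ v ℕ.+ w ≡ u ℕ.+ w ℕ.+ v
          regroup = solve-∀

    f-root⇒unit : ∀ a → a ℕ.^ n ℕ.+ C ≋ a ℕ.^ n₁ → Unit a
    f-root⇒unit a f-root a≋0 = C-unit (𝔽-Reasoning.begin
      C                        𝔽-Reasoning.≈⟨ 𝔽ₚ.+≋ʳ C (𝔽ₚ.*≋ʳ (a ℕ.^ n₁) a≋0) ⟨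
      a ℕ.^ n ℕ.+ C            𝔽-Reasoning.≈⟨ f-root ⟩
      a ℕ.^ n₁                 𝔽-Reasoning.≡⟨ ≡.cong (a ℕ.^_) n₁≡1+n₂ ⟩
      a ℕ.* a ℕ.^ n₂           𝔽-Reasoning.≈⟨ 𝔽ₚ.*≋ʳ (a ℕ.^ n₂) a≋0 ⟩
      0                        𝔽-Reasoning.∎)

    -- With x = g^s and a = -1/x: a (a - 1) = (1 + x) / x² = x^(n-2) α t / 4.
    a[a-1]-at-root : ∀ s a → a ≋ -1/x (γ s) → M (γ s) ≋ 0 → a ℕ.* (a ℕ.+ minus-one) ≋ recip4 ℕ.* γ s ℕ.^ n₂ ℕ.* (α ℕ.* t)
    a[a-1]-at-root s a a≋ Mγs≋0 = 𝔽ₚ.cancelʳ (𝔽-Reasoning.begin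
      a ℕ.* (a ℕ.+ minus-one) ℕ.* (x ℕ.* x)               𝔽-Reasoning.≡⟨ regroup a minus-one x ⟩
      (a ℕ.* x) ℕ.* (a ℕ.* x ℕ.+ minus-one ℕ.* x)         𝔽-Reasoning.≈⟨ 𝔽ₚ.*≋ ax≋-1 (𝔽ₚ.+≋ʳ (minus-one ℕ.* x) ax≋-1) ⟩
      minus-one ℕ.* (minus-one ℕ.+ minus-one ℕ.* x)       𝔽-Reasoning.≡⟨ regroup′ minus-one x ⟩
      minus-one ℕ.* minus-one ℕ.* (1 ℕ.+ x)               𝔽-Reasoning.≈⟨ 𝔽ₚ.*≋ʳ (1 ℕ.+ x) minus-one²≋1 ⟩
      1 ℕ.* (1 ℕ.+ x)                                     𝔽-Reasoning.≡⟨ ℕₚ.*-identityˡ _ ⟩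
      1 ℕ.+ x                                             𝔽-Reasoning.≈⟨ M≋0⇒ x Mγs≋0 ⟩
      Z x                                                 𝔽-Reasoning.≈⟨ xⁿαt/4≋Z x ⟨
      recip4 ℕ.* x ℕ.^ n ℕ.* (α ℕ.* t)
        𝔽-Reasoning.≡⟨ ≡.trans (≡.cong (λ m → recip4 ℕ.* x ℕ.^ suc m ℕ.* (α ℕ.* t)) n₁≡1+n₂)
                               (regroup″ recip4 (x ℕ.^ n₂) (α ℕ.* t) x) ⟩
      (recip4 ℕ.* x ℕ.^ n₂ ℕ.* (α ℕ.* t)) ℕ.* (x ℕ.* x)   𝔽-Reasoning.∎) (𝔽ₚ.unit-* (γ-unit s) (γ-unit s))
      where
      x : ℕ
      x = γ s
      ax≋-1 : a ℕ.* x ≋ minus-one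
      ax≋-1 = ≋-trans (𝔽ₚ.*≋ʳ x a≋) (≋-trans (≡⇒≋ (ℕₚ.*-comm (-1/x x) x)) (x·-1/x (γ-unit s)))
      regroup : ∀ a b x → a ℕ.* (a ℕ.+ b) ℕ.* (x ℕ.* x) ≡ (a ℕ.* x) ℕ.* (a ℕ.* x ℕ.+ b ℕ.* x)
      regroup = solve-∀
      regroup′ : ∀ o y → o ℕ.* (o ℕ.+ o ℕ.* y) ≡ o ℕ.* o ℕ.* (1 ℕ.+ y)
      regroup′ = solve-∀
      regroup″ : ∀ i y a x → i ℕ.* (x ℕ.* (x ℕ.* y)) ℕ.* a ≡ (i ℕ.* y ℕ.* a) ℕ.* (x ℕ.* x)
      regroup″ = solve-∀

    φ-at-root : ∀ s a → a ≋ -1/x (γ s) → M (γ s) ≋ 0 → φ (a ℕ.* (a ℕ.+ p ℕ.∸ 1)) ≈ W s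
    φ-at-root s a a≋ Mγs≋0 = begin
      chr φi (a ℕ.* (a ℕ.+ p ℕ.∸ 1))    ≈⟨ reflexive (≡.cong (λ i → chr i (a ℕ.* (a ℕ.+ p ℕ.∸ 1))) φi≡h) ⟩
      chr h (a ℕ.* (a ℕ.+ p ℕ.∸ 1))     ≈⟨ χ-exp h _ e a[a-1]≋gᵉ ⟩
      ω^ (h ℕ.* e)                      ≈⟨ ω^-cong he≋ ⟩
      W s                               ∎
      where
      e : ℕ
      e = (log₂ ℕ.+ log₂) ℕ.* (1 ℕ.+ 2 ℕ.* q) ℕ.+ s ℕ.* n₂ ℕ.+ log-αt
      g^e≡ : g ℕ.^ e ≡ recip (g ℕ.^ log₂ ℕ.* g ℕ.^ log₂) ℕ.* (g ℕ.^ s) ℕ.^ n₂ ℕ.* g ℕ.^ log-αt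
      g^e≡ = ≡.trans (ℕₚ.^-distribˡ-+-* g ((log₂ ℕ.+ log₂) ℕ.* (1 ℕ.+ 2 ℕ.* q) ℕ.+ s ℕ.* n₂) log-αt)
               (≡.cong (ℕ._* g ℕ.^ log-αt) (≡.trans (ℕₚ.^-distribˡ-+-* g ((log₂ ℕ.+ log₂) ℕ.* (1 ℕ.+ 2 ℕ.* q)) (s ℕ.* n₂))
                 (≡.cong₂ ℕ._*_ (≡.trans (≡.sym (ℕₚ.^-*-assoc g (log₂ ℕ.+ log₂) (1 ℕ.+ 2 ℕ.* q)))
                                         (≡.cong recip (ℕₚ.^-distribˡ-+-* g log₂ log₂)))
                                (≡.sym (ℕₚ.^-*-assoc g s n₂)))))
      a[a-1]≋gᵉ : a ℕ.* (a ℕ.+ p ℕ.∸ 1) ≋ g ℕ.^ e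
      a[a-1]≋gᵉ = 𝔽-Reasoning.begin
        a ℕ.* (a ℕ.+ p ℕ.∸ 1)                         𝔽-Reasoning.≡⟨ ≡.cong (a ℕ.*_) (ℕₚ.+-∸-assoc a {p} {1} (s≤s z≤n)) ⟩
        a ℕ.* (a ℕ.+ minus-one)                       𝔽-Reasoning.≈⟨ a[a-1]-at-root s a a≋ Mγs≋0 ⟩
        recip4 ℕ.* γ s ℕ.^ n₂ ℕ.* (α ℕ.* t)
          𝔽-Reasoning.≈⟨ 𝔽ₚ.*≋ (𝔽ₚ.*≋ (recip-cong (𝔽ₚ.*≋ g^log₂ g^log₂)) (𝔽ₚ.^≋ n₂ (≋-sym (γ≋ s)))) g^log-αt ⟨
        recip (g ℕ.^ log₂ ℕ.* g ℕ.^ log₂) ℕ.* (g ℕ.^ s) ℕ.^ n₂ ℕ.* g ℕ.^ log-αt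
          𝔽-Reasoning.≡⟨ g^e≡ ⟨
        g ℕ.^ e                                       𝔽-Reasoning.∎
      -- φ(x^(n-2)) = φ(x^n): the exponents h s (n - 2) and h s n differ by a multiple of p - 1.
      he≋ : h ℕ.* e ℤₙ.≋ h ℕ.* (s ℕ.* n ℕ.+ log-αt)
      he≋ = ℤₙ.≋-trans (ℤₙ.≋-sym (+hh≋ (h ℕ.* e) s))
              (ℤₙ.≋-trans (ℤₙ.≡⇒≋ (≡.trans (regroup h log₂ q s n₂ log-αt)
                                            (≡.cong (λ m → h ℕ.* (s ℕ.* suc m ℕ.+ log-αt) ℕ.+ (h ℕ.+ h) ℕ.* (log₂ ℕ.* (1 ℕ.+ 2 ℕ.* q)))
                                                    (≡.sym n₁≡1+n₂))))
                          (+hh≋ (h ℕ.* (s ℕ.* n ℕ.+ log-αt)) _))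
        where
        regroup : ∀ h b q s k l → h ℕ.* ((b ℕ.+ b) ℕ.* (1 ℕ.+ 2 ℕ.* q) ℕ.+ s ℕ.* k ℕ.+ l) ℕ.+ (h ℕ.+ h) ℕ.* s
                    ≡ h ℕ.* (s ℕ.* suc (suc k) ℕ.+ l) ℕ.+ (h ℕ.+ h) ℕ.* (b ℕ.* (1 ℕ.+ 2 ℕ.* q))
        regroup = solve-∀

    -- s ↦ -1/g^s is a bijection from {s < p - 1 | M (g^s) = 0} onto the roots of f_t.
    root-at : ℕ → ℕ
    root-at s = -1/x (γ s) % p

    exponent-of-root : ℕ → ℕ
    exponent-of-root a = log (-1/x a)

    root-at≋ : ∀ s → root-at s ≋ -1/x (γ s)
    root-at≋ s = 𝔽ₚ.%≋ (-1/x (γ s))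

    root-at-is-root : ∀ s → s < N → M-vanishes s ≡ true →
      root-at s < p × isRoot (root-at s) ≡ true × exponent-of-root (root-at s) ≡ s
    root-at-is-root s s<N Ms≡0 = m%n<n (-1/x (γ s)) p , ≡⇒≡ᵇ (un≋ f-root) , log-unique s s<N gˢ≋
      where
      open Reciprocal (root-at s) (γ s)
             (≋-trans (𝔽ₚ.*≋ʳ (γ s) (root-at≋ s)) (≋-trans (≡⇒≋ (ℕₚ.*-comm (-1/x (γ s)) (γ s))) (x·-1/x (γ-unit s))))
             (γ-unit s)
      f-root : root-at s ℕ.^ n ℕ.+ C ≋ root-at s ℕ.^ n₁
      f-root = M-zero⇒f-root (M≋0⇒ (γ s) (mk≋ (≡ᵇ⇒≡ Ms≡0)))
      gˢ≋ : g ℕ.^ s ≋ -1/x (root-at s)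
      gˢ≋ = ≋-trans (≋-sym (γ≋ s)) (≋-trans (≋-sym (-1/x-involutive (γ-unit s)))
                                             (𝔽ₚ.*≋ˡ minus-one (recip-cong (≋-sym (root-at≋ s)))))

    root-is-root-at : ∀ a → a < p → isRoot a ≡ true →
      exponent-of-root a < N × M-vanishes (exponent-of-root a) ≡ true × root-at (exponent-of-root a) ≡ a
    root-is-root-at a a<p a-root =
      log<N , ≡⇒≡ᵇ (un≋ (⇒M≋0 x (f-root⇒M-zero f-root))) ,
      𝔽ₚ.≋⇒≡-below (m%n<n (-1/x x) p) a<p
        (≋-trans (root-at≋ (exponent-of-root a)) (≋-trans (𝔽ₚ.*≋ˡ minus-one (recip-cong x≋)) (-1/x-involutive a-unit)))
      where
      f-root : a ℕ.^ n ℕ.+ C ≋ a ℕ.^ n₁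
      f-root = mk≋ (≡ᵇ⇒≡ a-root)
      a-unit : Unit a
      a-unit = f-root⇒unit a f-root
      log<N : log (-1/x a) < N
      log<N = proj₁ (log-spec (-1/x a) (-1/x-unit a-unit))
      x : ℕ
      x = γ (exponent-of-root a)
      x≋ : x ≋ -1/x a
      x≋ = ≋-trans (γ≋ (exponent-of-root a)) (g^log (-1/x-unit a-unit))
      open Reciprocal a x (≋-trans (𝔽ₚ.*≋ˡ a x≋) (x·-1/x a-unit)) (γ-unit (exponent-of-root a))

    root-sum : Carrier
    root-sum = Σ< p (λ a → if isRoot a then φ (a ℕ.* (a ℕ.+ p ℕ.∸ 1)) else 0#)

    ΣWP≈p·root-sum : Σ< N (λ s → W s * P s) ≈ fromℕ p * root-sum
    ΣWP≈p·root-sum = begin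
      Σ< N (λ s → W s * P s)                                    ≈⟨ Σ<-cong N pull-out-p ⟩
      Σ< N (λ s → fromℕ p * (if M-vanishes s then W s else 0#)) ≈⟨ *-distribˡ-Σ< N _ _ ⟨
      fromℕ p * Σ< N (λ s → if M-vanishes s then W s else 0#)   ≈⟨ *-congˡ (Σ<-cong-< N use-φ-at-root) ⟩
      fromℕ p * Σ< N (λ s → if M-vanishes s then f (root-at s) else 0#)
        ≈⟨ *-congˡ (Σ<-reindex N p M-vanishes isRoot root-at exponent-of-root f root-at-is-root root-is-root-at) ⟩
      fromℕ p * root-sum                                        ∎
      where
      f : ℕ → Carrier
      f a = φ (a ℕ.* (a ℕ.+ p ℕ.∸ 1))
      pull-out-p : ∀ s → W s * P s ≈ fromℕ p * (if M-vanishes s then W s else 0#)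
      pull-out-p s with M-vanishes s
      ... | true = *-comm _ _
      ... | false = trans (zeroʳ _) (sym (zeroʳ _))
      use-φ-at-root : ∀ s → s < N → (if M-vanishes s then W s else 0#) ≈ (if M-vanishes s then f (root-at s) else 0#)
      use-φ-at-root s _ with M-vanishes s in Ms≡0
      ... | true = sym (φ-at-root s (root-at s) (root-at≋ s) (mk≋ (≡ᵇ⇒≡ Ms≡0)))
      ... | false = refl

    A≈RHS : A ≈ RHS
    A≈RHS = begin
      A                                                 ≈⟨ A≈NGT+NG ⟩
      fromℕ N * G * T + fromℕ N * G                     ≈⟨ +-congʳ (*-congˡ (trans T≈ΣW[P-1] ΣW[P-1]≈)) ⟩
      fromℕ N * G * (fromℕ p * root-sum - ΣW) + fromℕ N * G
        ≈⟨ +-congʳ (distribˡ _ _ _) ⟩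
      (fromℕ N * G * (fromℕ p * root-sum) + fromℕ N * G * - ΣW) + fromℕ N * G
        ≈⟨ +-assoc _ _ _ ⟩
      fromℕ N * G * (fromℕ p * root-sum) + (fromℕ N * G * - ΣW + fromℕ N * G)
        ≈⟨ +-cong regroup (trans (+-comm _ _) (trans (+-congʳ (sym (*-identityʳ _))) (sym (distribˡ _ _ _)))) ⟩
      fromℕ (p ℕ.* N) * G * root-sum + fromℕ N * G * (1# - ΣW)
        ≈⟨ +-cong (*-congʳ (*-congˡ (sym gauss-φ))) (*-cong (*-congˡ (sym gauss-φ)) (sym β≈1-ΣW)) ⟩
      RHS                                               ∎
      where
      ΣW : Carrier
      ΣW = Σ< N W
      ΣW[P-1]≈ : Σ< N (λ s → W s * (P s - 1#)) ≈ fromℕ p * root-sum - ΣW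
      ΣW[P-1]≈ = begin
        Σ< N (λ s → W s * (P s - 1#))        ≈⟨ Σ<-cong N (λ s → trans (distribˡ _ _ _) (+-congˡ (x*-1≈-x _))) ⟩
        Σ< N (λ s → W s * P s + - W s)       ≈⟨ Σ<-distrib-+ N _ _ ⟩
        Σ< N (λ s → W s * P s) + Σ< N (λ s → - W s)  ≈⟨ +-cong ΣWP≈p·root-sum (Σ<-neg N W) ⟩
        fromℕ p * root-sum - ΣW              ∎
      regroup : fromℕ N * G * (fromℕ p * root-sum) ≈ fromℕ (p ℕ.* N) * G * root-sum
      regroup = trans (solve 4 (λ a b c d → (a ⊛ b) ⊛ (c ⊛ d) ⊜ ((c ⊛ a) ⊛ b) ⊛ d) refl (fromℕ N) G (fromℕ p) root-sum)
                      (*-congʳ (*-congʳ (sym (fromℕ-homo-* p N))))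

odd-prime : ∀ p → Prime p → 3 ≤ p → Σ ℕ (λ q → p ≡ 3 ℕ.+ 2 ℕ.* q)
odd-prime p p-prime 3≤p with p % 2 in p%2≡r | p / 2 in p/2≡k
... | zero | k = ⊥-elim (prime⇒¬composite p-prime (composite-≢ 2 {{_}} {{prime⇒nonZero p-prime}} (ℕₚ.<⇒≢ 3≤p) 2∣p))
  where
  2∣p : 2 ∣ p
  2∣p = divides k (≡.trans (div-mod-2 p p%2≡r p/2≡k) (ℕₚ.*-comm 2 k))
... | suc zero | zero with ≡.subst (3 ≤_) (div-mod-2 p p%2≡r p/2≡k) 3≤p
...   | s≤s ()
odd-prime p p-prime 3≤p | suc zero | suc k = k , ≡.trans (div-mod-2 p p%2≡r p/2≡k) (odd k)
  where
  odd : ∀ k → 1 ℕ.+ 2 ℕ.* suc k ≡ 3 ℕ.+ 2 ℕ.* k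
  odd = solve-∀
odd-prime p p-prime 3≤p | suc (suc r) | _ with ≡.subst (ℕ._< 2) p%2≡r (m%n<n p 2)
...   | s≤s (s≤s ())

open import Data.Nat using (_*_; _∸_)

proposition5p3 : ∀ {c ℓ : Level} (R : CommutativeRing c ℓ) → InRing.IsChar0Domain R →
    (p g n t : ℕ) (ω ζ : CommutativeRing.Carrier R) →
    Prime p → 3 ≤ p → 3 ≤ n → unitMod p (n * (n ∸ 1)) →
    IsPrimitiveRoot p g →
    InRing.IsPrimRootOfUnity R (p ∸ 1) ω → InRing.IsPrimRootOfUnity R p ζ →
    1 ≤ t → t < p →
    CommutativeRing._≈_ R (InRing.Chars.Prop53.A R p g ω ζ n t)
      (InRing.Chars.Prop53.RHS R p g ω ζ n t)
proposition5p3 R (_ , no-zero-divisors , _) p g (suc n₁) t ω ζ p-prime 3≤p _ nn₁-unit g-primitive ω-primitive ζ-primitive 1≤t t<p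
  with odd-prime p p-prime 3≤p
... | q , ≡.refl = CharacterSums.Proposition53.A≈RHS R no-zero-divisors q g ω ζ p-prime g-primitive ω-primitive ζ-primitive
                     n₁ t nn₁-unit 1≤t t<p
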